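{- Let $p$ be an odd prime and let $1\leq i<p-1$ be an integer. For an integer $1\leq l\leq i+1$, set \[G_i(l)=\left(\sum_{k=1}^l(-1)^{k-1}(k-1)!\,S_{\leq i}(l,k)\right)+\frac{p \cdot l!}{(l+p-1)!}\,S_{\leq i}(l+p-1,p) \text{.}\] Then $G_i(l)=-1+O(p)$ if $l=i+1$, and $G_i(l)=O(p)$ if $l\leq i$.
   Context: For integers $n\geq k\geq 0$ the incomplete exponential Bell polynomial is \[B_{n,k}(x_1,\dots,x_{n-k+1})=\sum_{\substack{(j_1,\dots,j_{n-k+1})\in\mathbb{N}^{n-k+1}\\ \sum_t j_t=k,\ \sum_t t j_t=n}}\frac{n!}{j_1!\cdots j_{n-k+1}!}\prod_{t=1}^{n-k+1}\left(\frac{x_t}{t!}\right)^{j_t}.\] The Stirling number of the second kind is $S(n,k)=B_{n,k}(1,1,\dots,1)$. For a positive integer $r$, the $r$-restricted Stirling number of the second kind is $S_{\leq r}(n,k)=S(n,k)$ if $n-k+1\leq r$, and $S_{\leq r}(n,k)=B_{n,k}(1,\dots,1,0,\dots,0)$ (first $r$ arguments equal to $1$, the rest $0$) otherwise; equivalently $\frac{1}{k!}\left(\sum_{m=1}^r\frac{t^m}{m!}\right)^k=\sum_{n\geq k}S_{\leq r}(n,k)\frac{t^n}{n!}$. Here $O(p)$ denotes a rational number of $p$-adic valuation at least $1$. -}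

module Defs where

open import Data.Nat as ℕ using (ℕ; zero; suc; _∸_; _!; _≤ᵇ_; _≡ᵇ_)
open import Data.Nat.Properties using (_!≢0)
open import Data.Nat.Divisibility using (_∣_)
open import Data.Bool using (Bool; true; false; _∧_; if_then_else_)
open import Data.Integer as ℤ using (ℤ; +_)
open import Data.Rational as ℚ using (ℚ; 0ℚ; 1ℚ; _+_; _*_; _/_; ↥_; ↧ₙ_)
open import Data.List using (List; []; _∷_; map; concatMap; filterᵇ; foldr; upTo)
open import Data.Vec using (Vec; []; _∷_)
open import Data.Product using (_×_)
open import Relation.Nullary using (¬_)

_^ℚ_ : ℚ → ℕ → ℚ
q ^ℚ zero  = 1ℚ
q ^ℚ suc n = q * (q ^ℚ n)

inv! : ℕ → ℚ
inv! n = (+ 1 / (n !)) {{n !≢0}}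

ℚ! : ℕ → ℚ
ℚ! n = + (n !) / 1

sumℚ : List ℚ → ℚ
sumℚ = foldr _+_ 0ℚ

vecsUpTo : (b m : ℕ) → List (Vec ℕ m)
vecsUpTo b zero    = [] ∷ []
vecsUpTo b (suc m) = concatMap (λ j → map (j ∷_) (vecsUpTo b m)) (upTo (suc b))

sumJ : ∀ {m} → Vec ℕ m → ℕ
sumJ []       = 0
sumJ (j ∷ js) = j ℕ.+ sumJ js

weightJ : ∀ {m} → ℕ → Vec ℕ m → ℕ
weightJ s []       = 0
weightJ s (j ∷ js) = s ℕ.* j ℕ.+ weightJ (suc s) js

termJ : ∀ {m} → (ℕ → ℚ) → ℕ → Vec ℕ m → ℚ
termJ x s []       = 1ℚ
termJ x s (j ∷ js) = inv! j * ((x s * inv! s) ^ℚ j) * termJ x (suc s) js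

-- incomplete exponential Bell polynomial B_{n,k}(x_1,...,x_{n-k+1});
-- x t is the argument x_t (t ≥ 1); the sum ranges over
-- (j_1,...,j_{n-k+1}) ∈ ℕ^{n-k+1} with Σ j_t = k and Σ t j_t = n
-- (each j_t ≤ k automatically, so enumerating j_t ∈ {0..k} is exhaustive).
bell : (n k : ℕ) → (ℕ → ℚ) → ℚ
bell n k x =
  ℚ! n * sumℚ (map (termJ x 1)
    (filterᵇ (λ v → (sumJ v ≡ᵇ k) ∧ (weightJ 1 v ≡ᵇ n))
             (vecsUpTo k (suc (n ∸ k)))))

stirling2 : ℕ → ℕ → ℚ
stirling2 n k = bell n k (λ _ → 1ℚ)

stirlingLE : (r n k : ℕ) → ℚ
stirlingLE r n k =
  if suc (n ∸ k) ≤ᵇ r then stirling2 n k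
  else bell n k (λ t → if t ≤ᵇ r then 1ℚ else 0ℚ)

-- q = O(p): q has p-adic valuation at least 1, i.e. (q in lowest terms)
-- p divides the numerator and does not divide the denominator.
O[_] : ℕ → ℚ → Set
O[ p ] q = (p ∣ ℤ.∣ ↥ q ∣) × ¬ (p ∣ ↧ₙ q)

signFact : ℕ → ℚ
signFact k = (if (k ∸ 1) ℕ.% 2 ≡ᵇ 0 then 1ℚ else ℚ.- 1ℚ) * ℚ! (k ∸ 1)

G : (p i l : ℕ) → ℚ
G p i l =
  sumℚ (map (λ k → signFact k * stirlingLE i l k) (Data.List.map suc (upTo l)))
  + ((+ (p ℕ.* (l !)) / ((l ℕ.+ p ∸ 1) !)) {{(l ℕ.+ p ∸ 1) !≢0}}) * stirlingLE i (l ℕ.+ p ∸ 1) p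

{-# OPTIONS --safe #-}
-- Write S_{≤i}(n, k) = n! · b(n, k), where b sums over the tuples of part multiplicities and
-- is computed by a recursion over the allowed part sizes. For Stirling weights this recursion
-- gives S(n+1, k+1) = S(n, k) + (k+1) S(n, k+1), hence Σ_k (-1)^{k-1} (k-1)! S(n, k) = [n = 1].
-- For l ≤ i the restriction does not affect S_{≤i}(l, k), so the first summand of G_i(l) is
-- [l = 1]; for l = i + 1 only S_{≤i}(i+1, 1) = 0 differs, and the first summand is -1.
-- The second summand is p · l! · b(l+p-1, p), where b is p-integral because all part sizes
-- are below p and, as p < l+p-1 < 2p, no size occurs p times; so it is O(p) for l ≥ 2.
-- For l = 1 it is 1/(p-1)!, and 1 + 1/(p-1)! = O(p) is Wilson's theorem, which itself follows
-- from the alternating identity at n = p since p divides S(p, k) for 1 < k < p.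
module Submission where

open import Defs
open import Data.Bool using (Bool; true; false; T; _∧_; if_then_else_)
open import Data.Bool.Properties using (∧-zeroʳ)
open import Data.Empty using (⊥-elim)
open import Data.Integer as ℤ using (ℤ)
import Data.Integer.Properties as ℤP
import Data.Integer.Divisibility.Signed as ℤD
open import Data.List using (List; []; _∷_; _++_; map; concatMap; filterᵇ; applyUpTo; upTo)
open import Data.List.Properties using (map-++; map-∘)
open import Data.Nat as ℕ using (ℕ; zero; suc; _≤_; _<_; z≤n; s≤s; _∸_; _≡ᵇ_; _≤ᵇ_; _≤?_; _<?_; _%_; _!; NonZero)
import Data.Nat.Coprimality as ℕC
open import Data.Nat.Divisibility as ℕD using (_∣_)
import Data.Nat.DivMod as ℕDM
open import Data.Nat.Primality using (Prime; euclidsLemma; prime⇒nonZero; prime⇒irreducible; ¬prime[0]; ¬prime[1])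
import Data.Nat.Properties as ℕP
open import Data.Product using (_×_; _,_; Σ-syntax)
open import Data.Rational as ℚ using (ℚ; mkℚ; 0ℚ; 1ℚ; _+_; _*_; -_; _/_; toℚᵘ)
import Data.Rational.Properties as ℚP
open import Data.Rational.Solver using (module +-*-Solver)
open import Data.Rational.Unnormalised as ℚᵘ using (ℚᵘ; mkℚᵘ; *≡*)
import Data.Rational.Unnormalised.Properties as ℚᵘP
open import Data.Sum using (_⊎_; inj₁; inj₂)
open import Data.Vec using (Vec; []; _∷_)
open import Relation.Binary.PropositionalEquality
open import Relation.Nullary using (Dec; yes; no; ¬_)

open +-*-Solver using (solve; _:+_; _:*_; :-_; _:=_; con)

∑ : ℕ → (ℕ → ℚ) → ℚ
∑ zero    f = 0ℚ
∑ (suc n) f = f 0 + ∑ n (λ j → f (suc j))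

syntax ∑ n (λ j → e) = ∑[ j < n ] e

∑-cong : ∀ n {f g : ℕ → ℚ} → (∀ j → j < n → f j ≡ g j) → ∑ n f ≡ ∑ n g
∑-cong zero    eq = refl
∑-cong (suc n) eq = cong₂ _+_ (eq 0 (s≤s z≤n)) (∑-cong n (λ j j<n → eq (suc j) (s≤s j<n)))

∑-≡0 : ∀ n {f : ℕ → ℚ} → (∀ j → j < n → f j ≡ 0ℚ) → ∑ n f ≡ 0ℚ
∑-≡0 n eq = trans (∑-cong n eq) (∑-const0 n)
  where
  ∑-const0 : ∀ n → ∑ n (λ _ → 0ℚ) ≡ 0ℚ
  ∑-const0 zero    = refl
  ∑-const0 (suc n) = cong (0ℚ +_) (∑-const0 n)

∑-+ : ∀ n (f g : ℕ → ℚ) → ∑[ j < n ] (f j + g j) ≡ ∑ n f + ∑ n g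
∑-+ zero    f g = refl
∑-+ (suc n) f g = trans (cong (f 0 + g 0 +_) (∑-+ n _ _))
  (solve 4 (λ a b c d → (a :+ b) :+ (c :+ d) := (a :+ c) :+ (b :+ d)) refl
     (f 0) (g 0) (∑ n (λ j → f (suc j))) (∑ n (λ j → g (suc j))))

∑-*ˡ : ∀ n (c : ℚ) (f : ℕ → ℚ) → ∑[ j < n ] (c * f j) ≡ c * ∑ n f
∑-*ˡ zero    c f = sym (ℚP.*-zeroʳ c)
∑-*ˡ (suc n) c f = trans (cong (c * f 0 +_) (∑-*ˡ n c _)) (sym (ℚP.*-distribˡ-+ c (f 0) _))

∑-snoc : ∀ n (f : ℕ → ℚ) → ∑ (suc n) f ≡ ∑ n f + f n
∑-snoc zero    f = trans (ℚP.+-identityʳ (f 0)) (sym (ℚP.+-identityˡ (f 0)))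
∑-snoc (suc n) f = trans (cong (f 0 +_) (∑-snoc n (λ j → f (suc j)))) (sym (ℚP.+-assoc (f 0) _ _))

∑-swap : ∀ n m (f : ℕ → ℕ → ℚ) → ∑[ j < n ] ∑[ r < m ] f j r ≡ ∑[ r < m ] ∑[ j < n ] f j r
∑-swap zero    m f = sym (∑-≡0 m (λ _ _ → refl))
∑-swap (suc n) m f = trans (cong (∑ m (f 0) +_) (∑-swap n m (λ j → f (suc j))))
  (sym (∑-+ m (f 0) (λ r → ∑[ j < n ] f (suc j) r)))

∑-extend : ∀ n m (f : ℕ → ℚ) → n ≤ m → (∀ j → n ≤ j → f j ≡ 0ℚ) → ∑ m f ≡ ∑ n f
∑-extend zero    m       f _         vanish = ∑-≡0 m (λ j _ → vanish j z≤n)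
∑-extend (suc n) (suc m) f (s≤s n≤m) vanish =
  cong (f 0 +_) (∑-extend n m (λ j → f (suc j)) n≤m (λ j n≤j → vanish (suc j) (s≤s n≤j)))

∑-single : ∀ n i (f : ℕ → ℚ) → i < n → (∀ j → j < n → j ≢ i → f j ≡ 0ℚ) → ∑ n f ≡ f i
∑-single (suc n) zero    f _         vanish =
  trans (cong (f 0 +_) (∑-≡0 n (λ j j<n → vanish (suc j) (s≤s j<n) (λ ())))) (ℚP.+-identityʳ (f 0))
∑-single (suc n) (suc i) f (s≤s i<n) vanish =
  trans (cong (_+ ∑[ j < n ] f (suc j)) (vanish 0 (s≤s z≤n) (λ ())))
    (trans (ℚP.+-identityˡ _)
      (∑-single n i (λ j → f (suc j)) i<n
        (λ j j<n j≢i → vanish (suc j) (s≤s j<n) (λ eq → j≢i (ℕP.suc-injective eq)))))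

sumℚ-map-applyUpTo : ∀ n (g : ℕ → ℚ) (h : ℕ → ℕ) → sumℚ (map g (applyUpTo h n)) ≡ ∑[ j < n ] g (h j)
sumℚ-map-applyUpTo zero    g h = refl
sumℚ-map-applyUpTo (suc n) g h = cong (g (h 0) +_) (sumℚ-map-applyUpTo n g (λ j → h (suc j)))

when : ∀ {P : Set} → Dec P → ℚ → ℚ
when (yes _) q = q
when (no _)  q = 0ℚ

module _ {P : Set} where

  when-yes : (d : Dec P) (q : ℚ) → P → when d q ≡ q
  when-yes (yes _) q _  = refl
  when-yes (no ¬p) q p = ⊥-elim (¬p p)

  when-no : (d : Dec P) (q : ℚ) → ¬ P → when d q ≡ 0ℚ
  when-no (yes p) q ¬p = ⊥-elim (¬p p)
  when-no (no _)  q _  = refl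

  when-0ℚ : (d : Dec P) → when d 0ℚ ≡ 0ℚ
  when-0ℚ (yes _) = refl
  when-0ℚ (no _)  = refl

  when-+ : (d : Dec P) (q r : ℚ) → when d (q + r) ≡ when d q + when d r
  when-+ (yes _) q r = refl
  when-+ (no _)  q r = refl

  when-*ˡ : (d : Dec P) (c q : ℚ) → when d (c * q) ≡ c * when d q
  when-*ˡ (yes _) c q = refl
  when-*ˡ (no _)  c q = sym (ℚP.*-zeroʳ c)

  ∑-when : (d : Dec P) (n : ℕ) (f : ℕ → ℚ) → ∑[ j < n ] when d (f j) ≡ when d (∑ n f)
  ∑-when (yes _) n f = refl
  ∑-when (no _)  n f = ∑-≡0 n (λ _ _ → refl)

when-⇔ : ∀ {A B : Set} (dA : Dec A) (dB : Dec B) q → (A → B) → (B → A) → when dA q ≡ when dB q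
when-⇔ (yes _) (yes _) q _ _ = refl
when-⇔ (yes a) (no ¬b) q f _ = ⊥-elim (¬b (f a))
when-⇔ (no ¬a) (yes b) q _ g = ⊥-elim (¬a (g b))
when-⇔ (no _)  (no _)  q _ _ = refl

when-≤-+ : ∀ a b n (f : ℕ → ℚ) →
  when (a ℕ.+ b ≤? n) (f (n ∸ (a ℕ.+ b))) ≡ when (a ≤? n) (when (b ≤? n ∸ a) (f (n ∸ a ∸ b)))
when-≤-+ a b n f with a ℕ.+ b ≤? n | a ≤? n
... | yes a+b≤n | no a≰n = ⊥-elim (a≰n (ℕP.≤-trans (ℕP.m≤m+n a b) a+b≤n))
... | no _      | no _   = refl
... | yes a+b≤n | yes _ with b ≤? n ∸ a
...   | yes _   = cong f (sym (ℕP.∸-+-assoc n a b))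
...   | no b≰n-a = ⊥-elim (b≰n-a (ℕP.m+n≤o⇒m≤o∸n b (subst (_≤ n) (ℕP.+-comm a b) a+b≤n)))
when-≤-+ a b n f | no a+b≰n | yes a≤n with b ≤? n ∸ a
...   | yes b≤n-a = ⊥-elim (a+b≰n (subst (a ℕ.+ b ≤_) (ℕP.m+[n∸m]≡n a≤n) (ℕP.+-monoʳ-≤ a b≤n-a)))
...   | no _      = refl

when-≤-comm : ∀ a b n (f : ℕ → ℚ) →
  when (b ≤? n) (when (a ≤? n ∸ b) (f (n ∸ b ∸ a))) ≡ when (a ≤? n) (when (b ≤? n ∸ a) (f (n ∸ a ∸ b)))
when-≤-comm a b n f = trans (sym (when-≤-+ b a n f))
  (trans (cong (λ c → when (c ≤? n) (f (n ∸ c))) (ℕP.+-comm b a)) (when-≤-+ a b n f))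

when-*-when : ∀ a b n (u c : ℚ) (f : ℕ → ℚ) →
    when (b ≤? n) (u * when (a ≤? n ∸ b) (c * f (n ∸ b ∸ a)))
  ≡ c * when (a ≤? n) (when (b ≤? n ∸ a) (u * f (n ∸ a ∸ b)))
when-*-when a b n u c f = begin
    when (b ≤? n) (u * when (a ≤? n ∸ b) (c * f (n ∸ b ∸ a)))
  ≡⟨ cong (λ z → when (b ≤? n) (u * z)) (when-*ˡ (a ≤? n ∸ b) c _) ⟩
    when (b ≤? n) (u * (c * w))
  ≡⟨ cong (when (b ≤? n)) (solve 3 (λ u c w → u :* (c :* w) := c :* (u :* w)) refl u c w) ⟩
    when (b ≤? n) (c * (u * w))
  ≡⟨ when-*ˡ (b ≤? n) c _ ⟩
    c * when (b ≤? n) (u * w)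
  ≡⟨ cong (λ z → c * when (b ≤? n) z) (sym (when-*ˡ (a ≤? n ∸ b) u _)) ⟩
    c * when (b ≤? n) (when (a ≤? n ∸ b) (u * f (n ∸ b ∸ a)))
  ≡⟨ cong (c *_) (when-≤-comm a b n (λ r → u * f r)) ⟩
    c * when (a ≤? n) (when (b ≤? n ∸ a) (u * f (n ∸ a ∸ b)))
  ∎
  where
  open ≡-Reasoning
  w = when (a ≤? n ∸ b) (f (n ∸ b ∸ a))

sumℚ-++ : ∀ (xs ys : List ℚ) → sumℚ (xs ++ ys) ≡ sumℚ xs + sumℚ ys
sumℚ-++ []       ys = sym (ℚP.+-identityˡ _)
sumℚ-++ (x ∷ xs) ys = trans (cong (x +_) (sumℚ-++ xs ys)) (sym (ℚP.+-assoc x _ _))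

module _ {A : Set} where

  filterᵇ-++ : ∀ (P : A → Bool) xs ys → filterᵇ P (xs ++ ys) ≡ filterᵇ P xs ++ filterᵇ P ys
  filterᵇ-++ P []       ys = refl
  filterᵇ-++ P (x ∷ xs) ys with P x
  ... | true  = cong (x ∷_) (filterᵇ-++ P xs ys)
  ... | false = filterᵇ-++ P xs ys

  filterᵇ-cong : ∀ {P Q : A → Bool} → (∀ v → P v ≡ Q v) → ∀ xs → filterᵇ P xs ≡ filterᵇ Q xs
  filterᵇ-cong         P≡Q []       = refl
  filterᵇ-cong {Q = Q} P≡Q (x ∷ xs) rewrite P≡Q x with Q x
  ... | true  = cong (x ∷_) (filterᵇ-cong P≡Q xs)
  ... | false = filterᵇ-cong P≡Q xs

  filterᵇ-none : ∀ (P : A → Bool) → (∀ v → P v ≡ false) → ∀ xs → filterᵇ P xs ≡ []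
  filterᵇ-none P none []       = refl
  filterᵇ-none P none (x ∷ xs) rewrite none x = filterᵇ-none P none xs

  sumℚ-map-*ˡ : ∀ (c : ℚ) (f : A → ℚ) xs → sumℚ (map (λ v → c * f v) xs) ≡ c * sumℚ (map f xs)
  sumℚ-map-*ˡ c f []       = sym (ℚP.*-zeroʳ c)
  sumℚ-map-*ˡ c f (x ∷ xs) = trans (cong (c * f x +_) (sumℚ-map-*ˡ c f xs)) (sym (ℚP.*-distribˡ-+ c (f x) _))

module _ {A B : Set} where

  filterᵇ-map : ∀ (P : B → Bool) (h : A → B) xs → filterᵇ P (map h xs) ≡ map h (filterᵇ (λ v → P (h v)) xs)
  filterᵇ-map P h []       = refl
  filterᵇ-map P h (x ∷ xs) with P (h x)
  ... | true  = cong (h x ∷_) (filterᵇ-map P h xs)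
  ... | false = filterᵇ-map P h xs

  sumℚ-filterᵇ-concatMap : ∀ (f : B → ℚ) (P : B → Bool) (g : A → List B) xs →
    sumℚ (map f (filterᵇ P (concatMap g xs))) ≡ sumℚ (map (λ x → sumℚ (map f (filterᵇ P (g x)))) xs)
  sumℚ-filterᵇ-concatMap f P g []       = refl
  sumℚ-filterᵇ-concatMap f P g (x ∷ xs) = begin
      sumℚ (map f (filterᵇ P (g x ++ concatMap g xs)))
    ≡⟨ cong (λ l → sumℚ (map f l)) (filterᵇ-++ P (g x) (concatMap g xs)) ⟩
      sumℚ (map f (filterᵇ P (g x) ++ filterᵇ P (concatMap g xs)))
    ≡⟨ cong sumℚ (map-++ f (filterᵇ P (g x)) _) ⟩
      sumℚ (map f (filterᵇ P (g x)) ++ map f (filterᵇ P (concatMap g xs)))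
    ≡⟨ sumℚ-++ (map f (filterᵇ P (g x))) _ ⟩
      sumℚ (map f (filterᵇ P (g x))) + sumℚ (map f (filterᵇ P (concatMap g xs)))
    ≡⟨ cong (sumℚ (map f (filterᵇ P (g x))) +_) (sumℚ-filterᵇ-concatMap f P g xs) ⟩
      sumℚ (map f (filterᵇ P (g x))) + sumℚ (map (λ x → sumℚ (map f (filterᵇ P (g x)))) xs)
    ∎
    where open ≡-Reasoning

fromℕ : ℕ → ℚ
fromℕ n = ℤ.+ n / 1

toℚᵘ-/ : ∀ (i : ℤ) d .{{_ : NonZero d}} → toℚᵘ (i / d) ℚᵘ.≃ (i ℚᵘ./ d)
toℚᵘ-/ i (suc d) = ℚP.toℚᵘ-fromℚᵘ (mkℚᵘ i d)

fromℕ-* : ∀ m n → fromℕ (m ℕ.* n) ≡ fromℕ m * fromℕ n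
fromℕ-* m n = ℚP.toℚᵘ-injective (ℚᵘP.≃-trans (toℚᵘ-/ (ℤ.+ (m ℕ.* n)) 1)
  (ℚᵘP.≃-trans (ℚᵘP.≃-trans (*≡* (cong (ℤ._* ℤ.+ 1) (ℤP.pos-* m n)))
                            (ℚᵘP.*-cong (ℚᵘP.≃-sym (toℚᵘ-/ (ℤ.+ m) 1)) (ℚᵘP.≃-sym (toℚᵘ-/ (ℤ.+ n) 1))))
  (ℚᵘP.≃-sym (ℚP.toℚᵘ-homo-* (fromℕ m) (fromℕ n)))))

fromℕ-+ : ∀ m n → fromℕ (m ℕ.+ n) ≡ fromℕ m + fromℕ n
fromℕ-+ m n = ℚP.toℚᵘ-injective (ℚᵘP.≃-trans (toℚᵘ-/ (ℤ.+ (m ℕ.+ n)) 1)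
  (ℚᵘP.≃-trans (ℚᵘP.≃-trans (*≡* eq)
                            (ℚᵘP.+-cong (ℚᵘP.≃-sym (toℚᵘ-/ (ℤ.+ m) 1)) (ℚᵘP.≃-sym (toℚᵘ-/ (ℤ.+ n) 1))))
  (ℚᵘP.≃-sym (ℚP.toℚᵘ-homo-+ (fromℕ m) (fromℕ n)))))
  where
  eq : ℤ.+ (m ℕ.+ n) ℤ.* ℤ.+ 1 ≡ (ℤ.+ m ℤ.* ℤ.+ 1 ℤ.+ ℤ.+ n ℤ.* ℤ.+ 1) ℤ.* ℤ.+ 1
  eq = cong (ℤ._* ℤ.+ 1) (trans (ℤP.pos-+ m n)
         (sym (cong₂ ℤ._+_ (ℤP.*-identityʳ (ℤ.+ m)) (ℤP.*-identityʳ (ℤ.+ n)))))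

[a/b]*b≡a : ∀ a b .{{_ : NonZero b}} → (ℤ.+ a / b) * fromℕ b ≡ fromℕ a
[a/b]*b≡a a (suc b) = ℚP.toℚᵘ-injective (ℚᵘP.≃-trans (ℚP.toℚᵘ-homo-* (ℤ.+ a / suc b) (fromℕ (suc b)))
  (ℚᵘP.≃-trans (ℚᵘP.*-cong (toℚᵘ-/ (ℤ.+ a) (suc b)) (toℚᵘ-/ (ℤ.+ suc b) 1))
  (ℚᵘP.≃-trans (*≡* eq) (ℚᵘP.≃-sym (toℚᵘ-/ (ℤ.+ a) 1)))))
  where
  eq : (ℤ.+ a ℤ.* ℤ.+ suc b) ℤ.* ℤ.+ 1 ≡ ℤ.+ a ℤ.* ℤ.+ (suc b ℕ.* 1)
  eq = trans (ℤP.*-identityʳ _) (cong (ℤ.+ a ℤ.*_) (cong ℤ.+_ (sym (ℕP.*-identityʳ (suc b)))))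

inv!*ℚ!≡1 : ∀ n → inv! n * ℚ! n ≡ 1ℚ
inv!*ℚ!≡1 n = [a/b]*b≡a 1 (n !) {{n ℕP.!≢0}}

ℚ!*inv!≡1 : ∀ n → ℚ! n * inv! n ≡ 1ℚ
ℚ!*inv!≡1 n = trans (ℚP.*-comm (ℚ! n) (inv! n)) (inv!*ℚ!≡1 n)

ℚ!-suc : ∀ n → ℚ! (suc n) ≡ fromℕ (suc n) * ℚ! n
ℚ!-suc n = fromℕ-* (suc n) (n !)

inv!-suc : ∀ n → inv! (suc n) * fromℕ (suc n) ≡ inv! n
inv!-suc n = begin
    inv! (suc n) * fromℕ (suc n)
  ≡⟨ sym (ℚP.*-identityʳ _) ⟩
    inv! (suc n) * fromℕ (suc n) * 1ℚ
  ≡⟨ cong (inv! (suc n) * fromℕ (suc n) *_) (sym (ℚ!*inv!≡1 n)) ⟩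
    inv! (suc n) * fromℕ (suc n) * (ℚ! n * inv! n)
  ≡⟨ solve 4 (λ a b c d → (a :* b) :* (c :* d) := (a :* (b :* c)) :* d) refl
       (inv! (suc n)) (fromℕ (suc n)) (ℚ! n) (inv! n) ⟩
    inv! (suc n) * (fromℕ (suc n) * ℚ! n) * inv! n
  ≡⟨ cong (λ z → inv! (suc n) * z * inv! n) (sym (ℚ!-suc n)) ⟩
    inv! (suc n) * ℚ! (suc n) * inv! n
  ≡⟨ cong (_* inv! n) (inv!*ℚ!≡1 (suc n)) ⟩
    1ℚ * inv! n
  ≡⟨ ℚP.*-identityˡ (inv! n) ⟩
    inv! n
  ∎
  where open ≡-Reasoning

*-cancelˡ-fromℕ-suc : ∀ n {q r} → fromℕ (suc n) * q ≡ fromℕ (suc n) * r → q ≡ r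
*-cancelˡ-fromℕ-suc n {q} {r} eq = begin
    q                            ≡⟨ sym (ℚP.*-identityˡ q) ⟩
    1ℚ * q                       ≡⟨ cong (_* q) (sym w*[1+n]≡1) ⟩
    (w * fromℕ (suc n)) * q      ≡⟨ ℚP.*-assoc w _ q ⟩
    w * (fromℕ (suc n) * q)      ≡⟨ cong (w *_) eq ⟩
    w * (fromℕ (suc n) * r)      ≡⟨ sym (ℚP.*-assoc w _ r) ⟩
    (w * fromℕ (suc n)) * r      ≡⟨ cong (_* r) w*[1+n]≡1 ⟩
    1ℚ * r                       ≡⟨ ℚP.*-identityˡ r ⟩
    r                            ∎
  where
  open ≡-Reasoning
  w = inv! (suc n) * ℚ! n
  w*[1+n]≡1 : w * fromℕ (suc n) ≡ 1ℚ
  w*[1+n]≡1 = trans (solve 3 (λ a b c → a :* b :* c := a :* (c :* b)) refl (inv! (suc n)) (ℚ! n) (fromℕ (suc n)))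
    (trans (cong (inv! (suc n) *_) (sym (ℚ!-suc n))) (inv!*ℚ!≡1 (suc n)))

T-injective : ∀ {b c : Bool} → (T b → T c) → (T c → T b) → b ≡ c
T-injective {true}  {true}  _ _ = refl
T-injective {true}  {false} f _ = ⊥-elim (f _)
T-injective {false} {true}  _ g = ⊥-elim (g _)
T-injective {false} {false} _ _ = refl

m+n≡ᵇo≡n≡ᵇo∸m : ∀ m n o → m ≤ o → (m ℕ.+ n ≡ᵇ o) ≡ (n ≡ᵇ o ∸ m)
m+n≡ᵇo≡n≡ᵇo∸m m n o m≤o = T-injective
  (λ h → ℕP.≡⇒≡ᵇ n (o ∸ m) (trans (sym (ℕP.m+n∸m≡n m n)) (cong (_∸ m) (ℕP.≡ᵇ⇒≡ _ _ h))))
  (λ h → ℕP.≡⇒≡ᵇ (m ℕ.+ n) o (trans (cong (m ℕ.+_) (ℕP.≡ᵇ⇒≡ _ _ h)) (ℕP.m+[n∸m]≡n m≤o)))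

m+n≡ᵇo≡false : ∀ m n o → ¬ m ≤ o → (m ℕ.+ n ≡ᵇ o) ≡ false
m+n≡ᵇo≡false m n o m≰o =
  T-injective {c = false} (λ h → m≰o (subst (m ≤_) (ℕP.≡ᵇ⇒≡ _ _ h) (ℕP.m≤m+n m n))) (λ ())

-- The Bell sum as a recursion over the part sizes s, s+1, …, s+m-1: bellFrom s m n k
-- is the sum of ∏_t (1/j_t!)(x_t/t!)^{j_t} over tuples with Σ j_t = k and Σ t j_t = n,
-- i.e. B_{n,k}/n! once the sizes 1, …, n-k+1 are all allowed.
module BellRecursion (x : ℕ → ℚ) where

  y : ℕ → ℚ
  y s = x s * inv! s

  partFactor : ℕ → ℕ → ℚ
  partFactor s j = inv! j * (y s ^ℚ j)

  bellFrom : (s m n k : ℕ) → ℚ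
  bellFrom s zero    n k = if (0 ≡ᵇ k) ∧ (0 ≡ᵇ n) then 1ℚ else 0ℚ
  bellFrom s (suc m) n k =
    ∑[ j < suc k ] when (s ℕ.* j ≤? n) (partFactor s j * bellFrom (suc s) m (n ∸ s ℕ.* j) (k ∸ j))

  countAndWeight : (s n k : ℕ) → ∀ {m} → Vec ℕ m → Bool
  countAndWeight s n k v = (sumJ v ≡ᵇ k) ∧ (weightJ s v ≡ᵇ n)

  enumeratedBell : (b s m n k : ℕ) → ℚ
  enumeratedBell b s m n k = sumℚ (map (termJ x s) (filterᵇ (countAndWeight s n k) (vecsUpTo b m)))

  enumeratedBell≡bellFrom : ∀ m s n k b → k ≤ b → enumeratedBell b s m n k ≡ bellFrom s m n k
  enumeratedBell≡bellFrom zero s n k b _ with (0 ≡ᵇ k) ∧ (0 ≡ᵇ n)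
  ... | true  = ℚP.+-identityʳ 1ℚ
  ... | false = refl
  enumeratedBell≡bellFrom (suc m) s n k b k≤b = begin
      enumeratedBell b s (suc m) n k
    ≡⟨ sumℚ-filterᵇ-concatMap (termJ x s) (countAndWeight s n k) (λ j → map (j ∷_) (vecsUpTo b m)) (upTo (suc b)) ⟩
      sumℚ (map column (upTo (suc b)))
    ≡⟨ sumℚ-map-applyUpTo (suc b) column (λ j → j) ⟩
      ∑ (suc b) column
    ≡⟨ ∑-cong (suc b) (λ j _ → column≡term j) ⟩
      ∑[ j < suc b ] when (j ≤? k) (term j)
    ≡⟨ ∑-extend (suc k) (suc b) (λ j → when (j ≤? k) (term j)) (s≤s k≤b)
                (λ j k<j → when-no (j ≤? k) _ (ℕP.<⇒≱ k<j)) ⟩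
      ∑[ j < suc k ] when (j ≤? k) (term j)
    ≡⟨ ∑-cong (suc k) (λ j j<1+k → when-yes (j ≤? k) (term j) (ℕP.≤-pred j<1+k)) ⟩
      bellFrom s (suc m) n k
    ∎
    where
    open ≡-Reasoning
    rest : ℕ → List (Vec ℕ m)
    rest j = filterᵇ (λ v → countAndWeight s n k (j ∷ v)) (vecsUpTo b m)
    column : ℕ → ℚ
    column j = sumℚ (map (termJ x s) (filterᵇ (countAndWeight s n k) (map (j ∷_) (vecsUpTo b m))))
    term : ℕ → ℚ
    term j = when (s ℕ.* j ≤? n) (partFactor s j * bellFrom (suc s) m (n ∸ s ℕ.* j) (k ∸ j))
    column≡factor*rest : ∀ j → column j ≡ partFactor s j * sumℚ (map (termJ x (suc s)) (rest j))
    column≡factor*rest j =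
      trans (cong (λ l → sumℚ (map (termJ x s) l)) (filterᵇ-map (countAndWeight s n k) (j ∷_) (vecsUpTo b m)))
        (trans (cong sumℚ (sym (map-∘ (rest j))))
          (sumℚ-map-*ˡ (partFactor s j) (termJ x (suc s)) (rest j)))
    column-vanishes : ∀ j → (∀ v → countAndWeight s n k (j ∷ v) ≡ false) → column j ≡ 0ℚ
    column-vanishes j none = trans (column≡factor*rest j)
      (trans (cong (λ l → partFactor s j * sumℚ (map (termJ x (suc s)) l)) (filterᵇ-none _ none (vecsUpTo b m)))
        (ℚP.*-zeroʳ (partFactor s j)))
    column≡term : ∀ j → column j ≡ when (j ≤? k) (term j)
    column≡term j with j ≤? k | s ℕ.* j ≤? n
    ... | yes j≤k | yes sj≤n = trans (column≡factor*rest j) (cong (partFactor s j *_)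
          (trans (cong (λ l → sumℚ (map (termJ x (suc s)) l))
                   (filterᵇ-cong (λ v → cong₂ _∧_ (m+n≡ᵇo≡n≡ᵇo∸m j (sumJ v) k j≤k)
                                                  (m+n≡ᵇo≡n≡ᵇo∸m (s ℕ.* j) (weightJ (suc s) v) n sj≤n))
                                 (vecsUpTo b m)))
                 (enumeratedBell≡bellFrom m (suc s) (n ∸ s ℕ.* j) (k ∸ j) b (ℕP.≤-trans (ℕP.m∸n≤m k j) k≤b))))
    ... | yes _   | no sj≰n = column-vanishes j (λ v →
          trans (cong ((j ℕ.+ sumJ v ≡ᵇ k) ∧_) (m+n≡ᵇo≡false (s ℕ.* j) (weightJ (suc s) v) n sj≰n))
                (∧-zeroʳ _))
    ... | no j≰k  | _       = column-vanishes j (λ v →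
          cong (_∧ (s ℕ.* j ℕ.+ weightJ (suc s) v ≡ᵇ n)) (m+n≡ᵇo≡false j (sumJ v) k j≰k))

  bell≡ℚ!*bellFrom : ∀ n k → bell n k x ≡ ℚ! n * bellFrom 1 (suc (n ∸ k)) n k
  bell≡ℚ!*bellFrom n k = cong (ℚ! n *_) (enumeratedBell≡bellFrom (suc (n ∸ k)) 1 n k k ℕP.≤-refl)

  bellFrom-noParts : ∀ m s n → bellFrom s m n 0 ≡ bellFrom s 0 n 0
  bellFrom-noParts zero    s n = refl
  bellFrom-noParts (suc m) s n rewrite ℕP.*-zeroʳ s =
    trans (ℚP.+-identityʳ _) (trans (ℚP.*-identityˡ _) (bellFrom-noParts m (suc s) n))

  bellFrom-empty : ∀ m s → bellFrom s m 0 0 ≡ 1ℚ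
  bellFrom-empty m s = bellFrom-noParts m s 0

  bellFrom-noParts-suc : ∀ m s n → bellFrom s m (suc n) 0 ≡ 0ℚ
  bellFrom-noParts-suc m s n = bellFrom-noParts m s (suc n)

  bellFrom-noParts-∸ : ∀ m s n t → t < n → bellFrom s m (n ∸ t) 0 ≡ 0ℚ
  bellFrom-noParts-∸ m s (suc n) t (s≤s t≤n) rewrite ℕP.+-∸-assoc 1 t≤n = bellFrom-noParts-suc m s (n ∸ t)

  bellFrom-tooLight : ∀ m s n k → n < s ℕ.* k → bellFrom s m n k ≡ 0ℚ
  bellFrom-tooLight zero    s n zero    n<0 rewrite ℕP.*-zeroʳ s = ⊥-elim (ℕP.n≮0 n<0)
  bellFrom-tooLight zero    s n (suc k) _   = refl
  bellFrom-tooLight (suc m) s n k n<sk = ∑-≡0 (suc k) term≡0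
    where
    term≡0 : ∀ j → j < suc k → when (s ℕ.* j ≤? n) (partFactor s j * bellFrom (suc s) m (n ∸ s ℕ.* j) (k ∸ j)) ≡ 0ℚ
    term≡0 j j<1+k with s ℕ.* j ≤? n
    ... | no _ = refl
    ... | yes sj≤n with ℕP.m≤n⇒∃[o]m+o≡n (ℕP.≤-pred j<1+k) | ℕP.m≤n⇒∃[o]m+o≡n sj≤n
    ... | k′ , refl | n′ , refl rewrite ℕP.m+n∸m≡n j k′ | ℕP.m+n∸m≡n (s ℕ.* j) n′ =
      trans (cong (partFactor s j *_) (bellFrom-tooLight m (suc s) n′ k′ n′<[1+s]k′)) (ℚP.*-zeroʳ (partFactor s j))
      where
      n′<[1+s]k′ : n′ < suc s ℕ.* k′
      n′<[1+s]k′ = ℕP.≤-trans (ℕP.+-cancelˡ-< (s ℕ.* j) n′ (s ℕ.* k′)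
                     (subst (s ℕ.* j ℕ.+ n′ <_) (ℕP.*-distribˡ-+ s j k′) n<sk))
                   (ℕP.m≤n+m (s ℕ.* k′) k′)

  -- A part of size t ≥ s + m would force n ≥ t + (k - 1) s ≥ s k + m.
  bellFrom-moreSizes : ∀ m d s n k → n < s ℕ.* k ℕ.+ m → bellFrom s m n k ≡ bellFrom s (m ℕ.+ d) n k
  bellFrom-moreSizes zero d s n zero lt rewrite ℕP.*-zeroʳ s with lt
  ... | ()
  bellFrom-moreSizes zero    d s n (suc k) lt = sym (bellFrom-tooLight d s n (suc k) (subst (n <_) (ℕP.+-identityʳ _) lt))
  bellFrom-moreSizes (suc m) d s n k lt = ∑-cong (suc k) term≡
    where
    term≡ : ∀ j → j < suc k →
        when (s ℕ.* j ≤? n) (partFactor s j * bellFrom (suc s) m (n ∸ s ℕ.* j) (k ∸ j))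
      ≡ when (s ℕ.* j ≤? n) (partFactor s j * bellFrom (suc s) (m ℕ.+ d) (n ∸ s ℕ.* j) (k ∸ j))
    term≡ j j<1+k with s ℕ.* j ≤? n
    ... | no _ = refl
    ... | yes sj≤n with ℕP.m≤n⇒∃[o]m+o≡n (ℕP.≤-pred j<1+k) | ℕP.m≤n⇒∃[o]m+o≡n sj≤n
    ... | k′ , refl | n′ , refl rewrite ℕP.m+n∸m≡n j k′ | ℕP.m+n∸m≡n (s ℕ.* j) n′ with k′
    ...   | zero    = cong (partFactor s j *_)
                        (trans (bellFrom-noParts m (suc s) n′) (sym (bellFrom-noParts (m ℕ.+ d) (suc s) n′)))
    ...   | suc k″ = cong (partFactor s j *_) (bellFrom-moreSizes m d (suc s) n′ (suc k″) n′<[1+s][1+k″]+m)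
      where
      sj+n′≤sj+[s[1+k″]+m] : s ℕ.* j ℕ.+ n′ ≤ s ℕ.* j ℕ.+ (s ℕ.* suc k″ ℕ.+ m)
      sj+n′≤sj+[s[1+k″]+m] = subst (s ℕ.* j ℕ.+ n′ ≤_)
        (trans (cong (ℕ._+ m) (ℕP.*-distribˡ-+ s j (suc k″))) (ℕP.+-assoc (s ℕ.* j) _ m))
        (ℕP.≤-pred (subst (suc (s ℕ.* j ℕ.+ n′) ≤_) (ℕP.+-suc (s ℕ.* (j ℕ.+ suc k″)) m) lt))
      n′<[1+s][1+k″]+m : n′ < suc s ℕ.* suc k″ ℕ.+ m
      n′<[1+s][1+k″]+m = s≤s (ℕP.≤-trans (ℕP.+-cancelˡ-≤ (s ℕ.* j) _ _ sj+n′≤sj+[s[1+k″]+m])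
                                         (ℕP.+-monoˡ-≤ m (ℕP.m≤n+m (s ℕ.* suc k″) k″)))

  partFactor-suc : ∀ s j → partFactor s (suc j) * fromℕ (suc j) ≡ partFactor s j * y s
  partFactor-suc s j =
    trans (solve 4 (λ i a b n → (i :* (a :* b)) :* n := ((i :* n) :* b) :* a) refl
            (inv! (suc j)) (y s) (y s ^ℚ j) (fromℕ (suc j)))
      (cong (λ z → z * (y s ^ℚ j) * y s) (inv!-suc j))

  -- weightedBellFrom φ is bellFrom with every tuple (j_s, j_{s+1}, …) weighted by Σ_t φ_t j_t.
  weightedBellFrom : (φ : ℕ → ℚ) (s m n k : ℕ) → ℚ
  weightedBellFrom φ s zero    n k = 0ℚ
  weightedBellFrom φ s (suc m) n k = ∑[ j < suc k ] when (s ℕ.* j ≤? n)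
    (partFactor s j * (φ s * fromℕ j * bellFrom (suc s) m (n ∸ s ℕ.* j) (k ∸ j)
                       + weightedBellFrom φ (suc s) m (n ∸ s ℕ.* j) (k ∸ j)))

  weightedBellFrom-noParts : ∀ (φ : ℕ → ℚ) m s n → weightedBellFrom φ s m n 0 ≡ 0ℚ
  weightedBellFrom-noParts φ zero    s n = refl
  weightedBellFrom-noParts φ (suc m) s n rewrite ℕP.*-zeroʳ s | weightedBellFrom-noParts φ m (suc s) n =
    trans (ℚP.+-identityʳ _)
      (trans (cong (partFactor s 0 *_)
               (trans (ℚP.+-identityʳ _) (trans (cong (_* b) (ℚP.*-zeroʳ (φ s))) (ℚP.*-zeroˡ b))))
        (ℚP.*-zeroʳ (partFactor s 0)))
    where b = bellFrom (suc s) m n 0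

  -- A weight α(n, k) that splits as φ_s j + α(n - s j, k - j) along the recursion is constant
  -- on the tuples of bellFrom s m n k, so it factors out.
  weightedBellFrom-additive : ∀ (φ : ℕ → ℚ) (α : ℕ → ℕ → ℚ) → α 0 0 ≡ 0ℚ →
    (∀ s n k j → j ≤ k → s ℕ.* j ≤ n → φ s * fromℕ j + α (n ∸ s ℕ.* j) (k ∸ j) ≡ α n k) →
    ∀ m s n k → weightedBellFrom φ s m n k ≡ α n k * bellFrom s m n k
  weightedBellFrom-additive φ α α00≡0 split zero s zero    zero    = sym (trans (cong (_* 1ℚ) α00≡0) (ℚP.*-zeroˡ 1ℚ))
  weightedBellFrom-additive φ α α00≡0 split zero s zero    (suc k) = sym (ℚP.*-zeroʳ (α 0 (suc k)))
  weightedBellFrom-additive φ α α00≡0 split zero s (suc n) zero    = sym (ℚP.*-zeroʳ (α (suc n) 0))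
  weightedBellFrom-additive φ α α00≡0 split zero s (suc n) (suc k) = sym (ℚP.*-zeroʳ (α (suc n) (suc k)))
  weightedBellFrom-additive φ α α00≡0 split (suc m) s n k =
    trans (∑-cong (suc k) term≡) (∑-*ˡ (suc k) (α n k) (λ j → when (s ℕ.* j ≤? n) (partFactor s j * b j)))
    where
    b : ℕ → ℚ
    b j = bellFrom (suc s) m (n ∸ s ℕ.* j) (k ∸ j)
    term≡ : ∀ j → j < suc k →
        when (s ℕ.* j ≤? n) (partFactor s j * (φ s * fromℕ j * b j + weightedBellFrom φ (suc s) m (n ∸ s ℕ.* j) (k ∸ j)))
      ≡ α n k * when (s ℕ.* j ≤? n) (partFactor s j * b j)
    term≡ j j<1+k with s ℕ.* j ≤? n
    ... | no _ = sym (ℚP.*-zeroʳ (α n k))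
    ... | yes sj≤n rewrite weightedBellFrom-additive φ α α00≡0 split m (suc s) (n ∸ s ℕ.* j) (k ∸ j) =
      trans (cong (partFactor s j *_)
              (trans (sym (ℚP.*-distribʳ-+ (b j) (φ s * fromℕ j) (α (n ∸ s ℕ.* j) (k ∸ j))))
                     (cong (_* b j) (split s n k j (ℕP.≤-pred j<1+k) sj≤n))))
        (solve 3 (λ a c q → a :* (c :* q) := c :* (a :* q)) refl (partFactor s j) (α n k) (b j))

  -- Weighting by φ and removing one part commute: a tuple with j parts of size s comes from
  -- one with j - 1 such parts, and j · partFactor s j = y_s · partFactor s (j - 1).
  weightedBellFrom-suc : ∀ (φ : ℕ → ℚ) m s n k → weightedBellFrom φ s m n (suc k) ≡
    ∑[ t < m ] when (s ℕ.+ t ≤? n) (φ (s ℕ.+ t) * y (s ℕ.+ t) * bellFrom s m (n ∸ (s ℕ.+ t)) k)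

  weightedBellFrom-suc-head : ∀ (φ : ℕ → ℚ) m s n k →
      ∑[ j < suc (suc k) ] when (s ℕ.* j ≤? n)
        (partFactor s j * (φ s * fromℕ j * bellFrom (suc s) m (n ∸ s ℕ.* j) (suc k ∸ j)))
    ≡ φ s * y s * when (s ≤? n) (bellFrom s (suc m) (n ∸ s) k)
  weightedBellFrom-suc-head φ m s n k = begin
      term 0 + ∑[ j < suc k ] term (suc j)
    ≡⟨ cong₂ _+_ term0≡0 (∑-cong (suc k) (λ j _ → term-suc j)) ⟩
      0ℚ + ∑[ j < suc k ] (c * when (s ≤? n) (rest j))
    ≡⟨ ℚP.+-identityˡ _ ⟩
      ∑[ j < suc k ] (c * when (s ≤? n) (rest j))
    ≡⟨ ∑-*ˡ (suc k) c (λ j → when (s ≤? n) (rest j)) ⟩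
      c * ∑[ j < suc k ] when (s ≤? n) (rest j)
    ≡⟨ cong (c *_) (∑-when (s ≤? n) (suc k) rest) ⟩
      c * when (s ≤? n) (bellFrom s (suc m) (n ∸ s) k)
    ∎
    where
    open ≡-Reasoning
    c = φ s * y s
    term rest : ℕ → ℚ
    term j = when (s ℕ.* j ≤? n) (partFactor s j * (φ s * fromℕ j * bellFrom (suc s) m (n ∸ s ℕ.* j) (suc k ∸ j)))
    rest j = when (s ℕ.* j ≤? n ∸ s) (partFactor s j * bellFrom (suc s) m (n ∸ s ∸ s ℕ.* j) (k ∸ j))
    b0 = bellFrom (suc s) m (n ∸ s ℕ.* 0) (suc k ∸ 0)
    term0≡0 : term 0 ≡ 0ℚ
    term0≡0 = trans (cong (when (s ℕ.* 0 ≤? n))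
                      (trans (cong (partFactor s 0 *_) (trans (cong (_* b0) (ℚP.*-zeroʳ (φ s))) (ℚP.*-zeroˡ b0)))
                             (ℚP.*-zeroʳ (partFactor s 0))))
                (when-0ℚ (s ℕ.* 0 ≤? n))
    term-suc : ∀ j → term (suc j) ≡ c * when (s ≤? n) (rest j)
    term-suc j = begin
        when (s ℕ.* suc j ≤? n) (f (n ∸ s ℕ.* suc j))
      ≡⟨ cong (λ z → when (z ≤? n) (f (n ∸ z))) (ℕP.*-suc s j) ⟩
        when (s ℕ.+ s ℕ.* j ≤? n) (f (n ∸ (s ℕ.+ s ℕ.* j)))
      ≡⟨ when-≤-+ s (s ℕ.* j) n f ⟩
        when (s ≤? n) (when (s ℕ.* j ≤? n ∸ s) (f (n ∸ s ∸ s ℕ.* j)))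
      ≡⟨ cong (λ z → when (s ≤? n) (when (s ℕ.* j ≤? n ∸ s) z))
              (shift (bellFrom (suc s) m (n ∸ s ∸ s ℕ.* j) (k ∸ j))) ⟩
        when (s ≤? n) (when (s ℕ.* j ≤? n ∸ s) (c * (partFactor s j * bellFrom (suc s) m (n ∸ s ∸ s ℕ.* j) (k ∸ j))))
      ≡⟨ cong (when (s ≤? n)) (when-*ˡ (s ℕ.* j ≤? n ∸ s) c _) ⟩
        when (s ≤? n) (c * rest j)
      ≡⟨ when-*ˡ (s ≤? n) c (rest j) ⟩
        c * when (s ≤? n) (rest j)
      ∎
      where
      f : ℕ → ℚ
      f r = partFactor s (suc j) * (φ s * fromℕ (suc j) * bellFrom (suc s) m r (k ∸ j))
      shift : ∀ q → partFactor s (suc j) * (φ s * fromℕ (suc j) * q) ≡ c * (partFactor s j * q)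
      shift q = trans (solve 4 (λ a p i q → a :* (p :* i :* q) := p :* (a :* i) :* q) refl
                        (partFactor s (suc j)) (φ s) (fromℕ (suc j)) q)
        (trans (cong (λ z → φ s * z * q) (partFactor-suc s j))
               (solve 4 (λ p a y q → p :* (a :* y) :* q := p :* y :* (a :* q)) refl (φ s) (partFactor s j) (y s) q))

  weightedBellFrom-suc-tail : ∀ (φ : ℕ → ℚ) m s n k →
      ∑[ j < suc (suc k) ] when (s ℕ.* j ≤? n) (partFactor s j * weightedBellFrom φ (suc s) m (n ∸ s ℕ.* j) (suc k ∸ j))
    ≡ ∑[ t < m ] when (suc s ℕ.+ t ≤? n) (φ (suc s ℕ.+ t) * y (suc s ℕ.+ t) * bellFrom s (suc m) (n ∸ (suc s ℕ.+ t)) k)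
  weightedBellFrom-suc-tail φ m s n k = begin
      ∑ (suc (suc k)) term
    ≡⟨ ∑-snoc (suc k) term ⟩
      ∑ (suc k) term + term (suc k)
    ≡⟨ trans (cong (∑ (suc k) term +_) last≡0) (ℚP.+-identityʳ _) ⟩
      ∑ (suc k) term
    ≡⟨ ∑-cong (suc k) (λ j j<1+k → term≡ j (ℕP.≤-pred j<1+k)) ⟩
      ∑[ j < suc k ] ∑[ t < m ] (c t * when (suc s ℕ.+ t ≤? n) (rest t j))
    ≡⟨ ∑-swap (suc k) m (λ j t → c t * when (suc s ℕ.+ t ≤? n) (rest t j)) ⟩
      ∑[ t < m ] ∑[ j < suc k ] (c t * when (suc s ℕ.+ t ≤? n) (rest t j))
    ≡⟨ ∑-cong m (λ t _ → trans (∑-*ˡ (suc k) (c t) (λ j → when (suc s ℕ.+ t ≤? n) (rest t j)))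
                          (trans (cong (c t *_) (∑-when (suc s ℕ.+ t ≤? n) (suc k) (rest t)))
                                 (sym (when-*ˡ (suc s ℕ.+ t ≤? n) (c t) _)))) ⟩
      ∑[ t < m ] when (suc s ℕ.+ t ≤? n) (c t * bellFrom s (suc m) (n ∸ (suc s ℕ.+ t)) k)
    ∎
    where
    open ≡-Reasoning
    c : ℕ → ℚ
    c t = φ (suc s ℕ.+ t) * y (suc s ℕ.+ t)
    term : ℕ → ℚ
    term j = when (s ℕ.* j ≤? n) (partFactor s j * weightedBellFrom φ (suc s) m (n ∸ s ℕ.* j) (suc k ∸ j))
    rest : ℕ → ℕ → ℚ
    rest t j = when (s ℕ.* j ≤? n ∸ (suc s ℕ.+ t))
      (partFactor s j * bellFrom (suc s) m (n ∸ (suc s ℕ.+ t) ∸ s ℕ.* j) (k ∸ j))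
    last≡0 : term (suc k) ≡ 0ℚ
    last≡0 rewrite ℕP.n∸n≡0 k | weightedBellFrom-noParts φ m (suc s) (n ∸ s ℕ.* suc k) =
      trans (cong (when (s ℕ.* suc k ≤? n)) (ℚP.*-zeroʳ (partFactor s (suc k)))) (when-0ℚ (s ℕ.* suc k ≤? n))
    term≡ : ∀ j → j ≤ k → term j ≡ ∑[ t < m ] (c t * when (suc s ℕ.+ t ≤? n) (rest t j))
    term≡ j j≤k = begin
        when (s ℕ.* j ≤? n) (partFactor s j * weightedBellFrom φ (suc s) m (n ∸ s ℕ.* j) (suc k ∸ j))
      ≡⟨ cong (λ z → when (s ℕ.* j ≤? n) (partFactor s j * weightedBellFrom φ (suc s) m (n ∸ s ℕ.* j) z))
              (ℕP.+-∸-assoc 1 j≤k) ⟩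
        when (s ℕ.* j ≤? n) (partFactor s j * weightedBellFrom φ (suc s) m (n ∸ s ℕ.* j) (suc (k ∸ j)))
      ≡⟨ cong (λ z → when (s ℕ.* j ≤? n) (partFactor s j * z)) (weightedBellFrom-suc φ m (suc s) (n ∸ s ℕ.* j) (k ∸ j)) ⟩
        when (s ℕ.* j ≤? n) (partFactor s j * ∑[ t < m ] when (suc s ℕ.+ t ≤? n ∸ s ℕ.* j) (c t * b t))
      ≡⟨ cong (when (s ℕ.* j ≤? n)) (sym (∑-*ˡ m (partFactor s j) _)) ⟩
        when (s ℕ.* j ≤? n) (∑[ t < m ] (partFactor s j * when (suc s ℕ.+ t ≤? n ∸ s ℕ.* j) (c t * b t)))
      ≡⟨ sym (∑-when (s ℕ.* j ≤? n) m _) ⟩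
        ∑[ t < m ] when (s ℕ.* j ≤? n) (partFactor s j * when (suc s ℕ.+ t ≤? n ∸ s ℕ.* j) (c t * b t))
      ≡⟨ ∑-cong m (λ t _ → when-*-when (suc s ℕ.+ t) (s ℕ.* j) n (partFactor s j) (c t)
                                        (λ r → bellFrom (suc s) m r (k ∸ j))) ⟩
        ∑[ t < m ] (c t * when (suc s ℕ.+ t ≤? n) (rest t j))
      ∎
      where
      b : ℕ → ℚ
      b t = bellFrom (suc s) m (n ∸ s ℕ.* j ∸ (suc s ℕ.+ t)) (k ∸ j)

  weightedBellFrom-suc φ zero    s n k = refl
  weightedBellFrom-suc φ (suc m) s n k = begin
      ∑[ j < suc (suc k) ] when (s ℕ.* j ≤? n) (partFactor s j * (φ s * fromℕ j * b j + w j))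
    ≡⟨ ∑-cong (suc (suc k)) (λ j _ →
         trans (cong (when (s ℕ.* j ≤? n)) (ℚP.*-distribˡ-+ (partFactor s j) (φ s * fromℕ j * b j) (w j)))
               (when-+ (s ℕ.* j ≤? n) (partFactor s j * (φ s * fromℕ j * b j)) (partFactor s j * w j))) ⟩
      ∑[ j < suc (suc k) ] (when (s ℕ.* j ≤? n) (partFactor s j * (φ s * fromℕ j * b j))
                            + when (s ℕ.* j ≤? n) (partFactor s j * w j))
    ≡⟨ ∑-+ (suc (suc k)) (λ j → when (s ℕ.* j ≤? n) (partFactor s j * (φ s * fromℕ j * b j)))
                         (λ j → when (s ℕ.* j ≤? n) (partFactor s j * w j)) ⟩
      ∑[ j < suc (suc k) ] when (s ℕ.* j ≤? n) (partFactor s j * (φ s * fromℕ j * b j))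
        + ∑[ j < suc (suc k) ] when (s ℕ.* j ≤? n) (partFactor s j * w j)
    ≡⟨ cong₂ _+_ (weightedBellFrom-suc-head φ m s n k) (weightedBellFrom-suc-tail φ m s n k) ⟩
      φ s * y s * when (s ≤? n) (bellFrom s (suc m) (n ∸ s) k) + ∑[ t < m ] g (suc s ℕ.+ t)
    ≡⟨ cong₂ _+_ (sym (trans (cong g (ℕP.+-identityʳ s)) (when-*ˡ (s ≤? n) (φ s * y s) _)))
                 (∑-cong m (λ t _ → cong g (sym (ℕP.+-suc s t)))) ⟩
      g (s ℕ.+ 0) + ∑[ t < m ] g (s ℕ.+ suc t)
    ∎
    where
    open ≡-Reasoning
    b w : ℕ → ℚ
    b j = bellFrom (suc s) m (n ∸ s ℕ.* j) (suc k ∸ j)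
    w j = weightedBellFrom φ (suc s) m (n ∸ s ℕ.* j) (suc k ∸ j)
    g : ℕ → ℚ
    g r = when (r ≤? n) (φ r * y r * bellFrom s (suc m) (n ∸ r) k)

  count*bellFrom : ∀ m s n k → fromℕ (suc k) * bellFrom s m n (suc k) ≡
    ∑[ t < m ] when (s ℕ.+ t ≤? n) (y (s ℕ.+ t) * bellFrom s m (n ∸ (s ℕ.+ t)) k)
  count*bellFrom m s n k =
    trans (sym (weightedBellFrom-additive (λ _ → 1ℚ) (λ _ k → fromℕ k) refl split m s n (suc k)))
      (trans (weightedBellFrom-suc (λ _ → 1ℚ) m s n k)
        (∑-cong m (λ t _ → cong (λ z → when (s ℕ.+ t ≤? n) (z * bellFrom s m (n ∸ (s ℕ.+ t)) k))
                                 (ℚP.*-identityˡ (y (s ℕ.+ t))))))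
    where
    split : ∀ s n k j → j ≤ k → s ℕ.* j ≤ n → 1ℚ * fromℕ j + fromℕ (k ∸ j) ≡ fromℕ k
    split s n k j j≤k _ = trans (cong (_+ fromℕ (k ∸ j)) (ℚP.*-identityˡ (fromℕ j)))
      (trans (sym (fromℕ-+ j (k ∸ j))) (cong fromℕ (ℕP.m+[n∸m]≡n j≤k)))

  size*bellFrom : ∀ m s n k → fromℕ n * bellFrom s m n (suc k) ≡
    ∑[ t < m ] when (s ℕ.+ t ≤? n) (fromℕ (s ℕ.+ t) * y (s ℕ.+ t) * bellFrom s m (n ∸ (s ℕ.+ t)) k)
  size*bellFrom m s n k =
    trans (sym (weightedBellFrom-additive fromℕ (λ n _ → fromℕ n) refl split m s n (suc k)))
      (weightedBellFrom-suc fromℕ m s n k)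
    where
    split : ∀ s n k j → j ≤ k → s ℕ.* j ≤ n → fromℕ s * fromℕ j + fromℕ (n ∸ s ℕ.* j) ≡ fromℕ n
    split s n k j _ sj≤n = trans (cong (_+ fromℕ (n ∸ s ℕ.* j)) (sym (fromℕ-* s j)))
      (trans (sym (fromℕ-+ (s ℕ.* j) (n ∸ s ℕ.* j))) (cong fromℕ (ℕP.m+[n∸m]≡n sj≤n)))

sign : ℕ → ℚ
sign k = if k % 2 ≡ᵇ 0 then 1ℚ else - 1ℚ

sign-+2 : ∀ k → sign (suc (suc k)) ≡ sign k
sign-+2 k = cong (λ r → if r ≡ᵇ 0 then 1ℚ else - 1ℚ) (trans (cong (_% 2) (ℕP.+-comm 2 k)) (ℕDM.[m+n]%n≡m%n k 2))

sign-suc : ∀ k → sign (suc k) ≡ - sign k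
sign-suc zero          = refl
sign-suc (suc zero)    = refl
sign-suc (suc (suc k)) = trans (sign-+2 (suc k)) (trans (sign-suc k) (cong -_ (sym (sign-+2 k))))

signFact-suc : ∀ k → signFact (suc (suc k)) ≡ - (fromℕ (suc k) * signFact (suc k))
signFact-suc k = trans (cong₂ _*_ (sign-suc k) (ℚ!-suc k))
  (solve 3 (λ s i f → (:- s) :* (i :* f) := :- (i :* (s :* f))) refl (sign k) (fromℕ (suc k)) (ℚ! k))

module StirlingNumbers where

  open BellRecursion (λ _ → 1ℚ) public

  -- S(n+1, k+1) = S(n, k) + (k+1) S(n, k+1), divided by (n+1)!: in the size recurrence the
  -- size-1 term is the first summand, and the other terms form the count recurrence.
  stirling-recurrence : ∀ m n k → n < suc m →
    fromℕ (suc n) * bellFrom 1 (suc m) (suc n) (suc k) ≡ bellFrom 1 (suc m) n k + fromℕ (suc k) * bellFrom 1 (suc m) n (suc k)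
  stirling-recurrence m n k n≤m = begin
      fromℕ (suc n) * bellFrom 1 (suc m) (suc n) (suc k)
    ≡⟨ size*bellFrom (suc m) 1 (suc n) k ⟩
      when (1 ≤? suc n) (fromℕ 1 * y 1 * bellFrom 1 (suc m) n k)
        + ∑[ t < m ] when (2 ℕ.+ t ≤? suc n) (fromℕ (2 ℕ.+ t) * y (2 ℕ.+ t) * bellFrom 1 (suc m) (n ∸ suc t) k)
    ≡⟨ cong₂ _+_ (ℚP.*-identityˡ (bellFrom 1 (suc m) n k)) (∑-cong m (λ t _ → shifted t)) ⟩
      bellFrom 1 (suc m) n k + ∑ m term
    ≡⟨ cong (bellFrom 1 (suc m) n k +_)
            (sym (trans (∑-snoc m term) (trans (cong (∑ m term +_) last≡0) (ℚP.+-identityʳ (∑ m term))))) ⟩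
      bellFrom 1 (suc m) n k + ∑ (suc m) term
    ≡⟨ cong (bellFrom 1 (suc m) n k +_) (sym (count*bellFrom (suc m) 1 n k)) ⟩
      bellFrom 1 (suc m) n k + fromℕ (suc k) * bellFrom 1 (suc m) n (suc k)
    ∎
    where
    open ≡-Reasoning
    term : ℕ → ℚ
    term t = when (1 ℕ.+ t ≤? n) (y (1 ℕ.+ t) * bellFrom 1 (suc m) (n ∸ (1 ℕ.+ t)) k)
    last≡0 : term m ≡ 0ℚ
    last≡0 = when-no (suc m ≤? n) _ (ℕP.<⇒≱ n≤m)
    [2+t]*y[2+t]≡y[1+t] : ∀ t → fromℕ (2 ℕ.+ t) * y (2 ℕ.+ t) ≡ y (1 ℕ.+ t)
    [2+t]*y[2+t]≡y[1+t] t = trans (cong (fromℕ (2 ℕ.+ t) *_) (ℚP.*-identityˡ (inv! (2 ℕ.+ t))))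
      (trans (ℚP.*-comm (fromℕ (2 ℕ.+ t)) (inv! (2 ℕ.+ t)))
        (trans (inv!-suc (suc t)) (sym (ℚP.*-identityˡ _))))
    shifted : ∀ t → when (2 ℕ.+ t ≤? suc n) (fromℕ (2 ℕ.+ t) * y (2 ℕ.+ t) * bellFrom 1 (suc m) (n ∸ suc t) k) ≡ term t
    shifted t = trans (cong (λ z → when (2 ℕ.+ t ≤? suc n) (z * bellFrom 1 (suc m) (n ∸ suc t) k)) ([2+t]*y[2+t]≡y[1+t] t))
      (when-⇔ (2 ℕ.+ t ≤? suc n) (1 ℕ.+ t ≤? n) _ ℕP.≤-pred s≤s)

  alternatingSum : (m K n : ℕ) → ℚ
  alternatingSum m K n = ∑[ k < K ] (signFact (suc k) * bellFrom 1 m n (suc k))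

  -- Multiplying by n+1 and applying the recurrence makes the sum telescope.
  [1+n]*alternatingSum : ∀ m K n → n < suc m → n ≤ K →
    fromℕ (suc n) * alternatingSum (suc m) (suc K) (suc n) ≡ bellFrom 1 (suc m) n 0
  [1+n]*alternatingSum m K n n≤m n≤K = begin
      fromℕ (suc n) * ∑[ k < suc K ] (signFact (suc k) * F (suc n) (suc k))
    ≡⟨ sym (∑-*ˡ (suc K) (fromℕ (suc n)) (λ k → signFact (suc k) * F (suc n) (suc k))) ⟩
      ∑[ k < suc K ] (fromℕ (suc n) * (signFact (suc k) * F (suc n) (suc k)))
    ≡⟨ ∑-cong (suc K) (λ k _ → expand k) ⟩
      ∑[ k < suc K ] (signFact (suc k) * F n k + b k)
    ≡⟨ ∑-+ (suc K) (λ k → signFact (suc k) * F n k) b ⟩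
      (signFact 1 * F n 0 + A) + ∑ (suc K) b
    ≡⟨ cong₂ _+_ (cong (_+ A) (ℚP.*-identityˡ (F n 0))) (∑-snoc K b) ⟩
      (F n 0 + A) + (B + b K)
    ≡⟨ cong (λ z → (F n 0 + A) + (B + z)) bK≡0 ⟩
      (F n 0 + A) + (B + 0ℚ)
    ≡⟨ solve 3 (λ f a b → (f :+ a) :+ (b :+ con 0ℚ) := f :+ (a :+ b)) refl (F n 0) A B ⟩
      F n 0 + (A + B)
    ≡⟨ cong (F n 0 +_) (trans (sym (∑-+ K _ _)) (∑-≡0 K (λ k _ → cancel k))) ⟩
      F n 0 + 0ℚ
    ≡⟨ ℚP.+-identityʳ _ ⟩
      F n 0
    ∎
    where
    open ≡-Reasoning
    F : ℕ → ℕ → ℚ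
    F = bellFrom 1 (suc m)
    b : ℕ → ℚ
    b k = signFact (suc k) * fromℕ (suc k) * F n (suc k)
    A = ∑[ k < K ] (signFact (suc (suc k)) * F n (suc k))
    B = ∑ K b
    expand : ∀ k → fromℕ (suc n) * (signFact (suc k) * F (suc n) (suc k)) ≡ signFact (suc k) * F n k + b k
    expand k = trans (solve 3 (λ i s f → i :* (s :* f) := s :* (i :* f)) refl (fromℕ (suc n)) (signFact (suc k)) (F (suc n) (suc k)))
      (trans (cong (signFact (suc k) *_) (stirling-recurrence m n k n≤m))
        (solve 4 (λ s f i g → s :* (f :+ i :* g) := s :* f :+ s :* i :* g) refl
          (signFact (suc k)) (F n k) (fromℕ (suc k)) (F n (suc k))))
    bK≡0 : b K ≡ 0ℚ
    bK≡0 = trans (cong (signFact (suc K) * fromℕ (suc K) *_)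
                   (bellFrom-tooLight (suc m) 1 n (suc K) (s≤s (subst (n ≤_) (sym (ℕP.+-identityʳ K)) n≤K))))
             (ℚP.*-zeroʳ (signFact (suc K) * fromℕ (suc K)))
    cancel : ∀ k → signFact (suc (suc k)) * F n (suc k) + b k ≡ 0ℚ
    cancel k = trans (cong (λ z → z * F n (suc k) + b k) (signFact-suc k))
      (solve 3 (λ i s f → (:- (i :* s)) :* f :+ s :* i :* f := con 0ℚ) refl (fromℕ (suc k)) (signFact (suc k)) (F n (suc k)))

  alternatingSum-1 : ∀ m K → alternatingSum (suc m) (suc K) 1 ≡ 1ℚ
  alternatingSum-1 m K = trans (sym (ℚP.*-identityˡ _))
    (trans ([1+n]*alternatingSum m K 0 (s≤s z≤n) z≤n) (bellFrom-empty (suc m) 1))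

  alternatingSum-2+ : ∀ m K n → suc n < suc m → suc n ≤ K → alternatingSum (suc m) (suc K) (suc (suc n)) ≡ 0ℚ
  alternatingSum-2+ m K n n<m n<K = *-cancelˡ-fromℕ-suc (suc n)
    (trans ([1+n]*alternatingSum m K (suc n) n<m n<K)
      (trans (bellFrom-noParts-suc (suc m) 1 n) (sym (ℚP.*-zeroʳ (fromℕ (suc (suc n)))))))

  bellFrom-diagonal : ∀ m n → bellFrom 1 (suc m) n n ≡ inv! n
  bellFrom-diagonal m zero    = bellFrom-empty (suc m) 1
  bellFrom-diagonal m (suc k) = *-cancelˡ-fromℕ-suc k (begin
      fromℕ (suc k) * bellFrom 1 (suc m) (suc k) (suc k)
    ≡⟨ count*bellFrom (suc m) 1 (suc k) k ⟩
      when (1 ≤? suc k) (y 1 * bellFrom 1 (suc m) k k)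
        + ∑[ t < m ] when (2 ℕ.+ t ≤? suc k) (y (2 ℕ.+ t) * bellFrom 1 (suc m) (k ∸ suc t) k)
    ≡⟨ cong₂ _+_ (ℚP.*-identityˡ (bellFrom 1 (suc m) k k)) (∑-≡0 m (λ t _ → tooLight t)) ⟩
      bellFrom 1 (suc m) k k + 0ℚ
    ≡⟨ ℚP.+-identityʳ _ ⟩
      bellFrom 1 (suc m) k k
    ≡⟨ bellFrom-diagonal m k ⟩
      inv! k
    ≡⟨ sym (inv!-suc k) ⟩
      inv! (suc k) * fromℕ (suc k)
    ≡⟨ ℚP.*-comm (inv! (suc k)) (fromℕ (suc k)) ⟩
      fromℕ (suc k) * inv! (suc k)
    ∎)
    where
    open ≡-Reasoning
    tooLight : ∀ t → when (2 ℕ.+ t ≤? suc k) (y (2 ℕ.+ t) * bellFrom 1 (suc m) (k ∸ suc t) k) ≡ 0ℚ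
    tooLight t with 2 ℕ.+ t ≤? suc k
    ... | no _    = refl
    ... | yes 2+t≤1+k = trans (cong (y (2 ℕ.+ t) *_) (bellFrom-tooLight (suc m) 1 (k ∸ suc t) k
            (subst (k ∸ suc t <_) (sym (ℕP.*-identityˡ k)) (ℕP.∸-monoʳ-< {k} {suc t} {0} (s≤s z≤n) (ℕP.≤-pred 2+t≤1+k)))))
          (ℚP.*-zeroʳ (y (2 ℕ.+ t)))

  bellFrom-singlePart : ∀ m n → suc n ≤ m → bellFrom 1 m (suc n) 1 ≡ inv! (suc n)
  bellFrom-singlePart m n n<m = trans (sym (ℚP.*-identityˡ (bellFrom 1 m (suc n) 1)))
    (trans (count*bellFrom m 1 (suc n) 0) (trans (∑-single m n _ n<m others) onlySize))
    where
    others : ∀ t → t < m → t ≢ n → when (1 ℕ.+ t ≤? suc n) (y (1 ℕ.+ t) * bellFrom 1 m (suc n ∸ (1 ℕ.+ t)) 0) ≡ 0ℚ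
    others t _ t≢n with 1 ℕ.+ t ≤? suc n
    ... | no _  = refl
    ... | yes 1+t≤1+n = trans (cong (y (1 ℕ.+ t) *_)
          (bellFrom-noParts-∸ m 1 (suc n) (suc t) (s≤s (ℕP.≤∧≢⇒< (ℕP.≤-pred 1+t≤1+n) t≢n))))
          (ℚP.*-zeroʳ (y (1 ℕ.+ t)))
    onlySize : when (1 ℕ.+ n ≤? suc n) (y (1 ℕ.+ n) * bellFrom 1 m (suc n ∸ (1 ℕ.+ n)) 0) ≡ inv! (suc n)
    onlySize = trans (when-yes (1 ℕ.+ n ≤? suc n) _ ℕP.≤-refl)
      (trans (cong (y (1 ℕ.+ n) *_) (trans (cong (λ z → bellFrom 1 m z 0) (ℕP.n∸n≡0 n)) (bellFrom-empty m 1)))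
        (trans (ℚP.*-identityʳ _) (ℚP.*-identityˡ _)))

  stirling2≡ℚ!*bellFrom : ∀ n k m → suc (n ∸ k) ≤ m → stirling2 n k ≡ ℚ! n * bellFrom 1 m n k
  stirling2≡ℚ!*bellFrom n k m n-k<m with ℕP.m≤n⇒∃[o]m+o≡n n-k<m
  ... | d , refl = trans (bell≡ℚ!*bellFrom n k) (cong (ℚ! n *_) (bellFrom-moreSizes (suc (n ∸ k)) d 1 n k n<k+[1+n-k]))
    where
    n<k+[1+n-k] : n < 1 ℕ.* k ℕ.+ suc (n ∸ k)
    n<k+[1+n-k] = subst (n <_) (trans (sym (ℕP.+-suc k (n ∸ k))) (cong (ℕ._+ suc (n ∸ k)) (sym (ℕP.*-identityˡ k))))
                    (s≤s (ℕP.m≤n+m∸n n k))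

  stirling2-singlePart : ∀ n → stirling2 (suc n) 1 ≡ 1ℚ
  stirling2-singlePart n = trans (stirling2≡ℚ!*bellFrom (suc n) 1 (suc n) ℕP.≤-refl)
    (trans (cong (ℚ! (suc n) *_) (bellFrom-singlePart (suc n) n ℕP.≤-refl)) (ℚ!*inv!≡1 (suc n)))

  stirling2-diagonal : ∀ n → stirling2 (suc n) (suc n) ≡ 1ℚ
  stirling2-diagonal n = trans (stirling2≡ℚ!*bellFrom (suc n) (suc n) (suc n) (s≤s (subst (_≤ n) (sym (ℕP.n∸n≡0 n)) z≤n)))
    (trans (cong (ℚ! (suc n) *_) (bellFrom-diagonal n (suc n))) (ℚ!*inv!≡1 (suc n)))

  ∑signFact*stirling2 : ∀ n → ∑[ j < n ] (signFact (suc j) * stirling2 n (suc j)) ≡ ℚ! n * alternatingSum n n n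
  ∑signFact*stirling2 n =
    trans (∑-cong n (λ j j<n → trans (cong (signFact (suc j) *_) (stirling2≡ℚ!*bellFrom n (suc j) n (n-j≤n j<n)))
                     (solve 3 (λ s a b → s :* (a :* b) := a :* (s :* b)) refl (signFact (suc j)) (ℚ! n) (bellFrom 1 n n (suc j)))))
      (∑-*ˡ n (ℚ! n) (λ j → signFact (suc j) * bellFrom 1 n n (suc j)))
    where
    n-j≤n : ∀ {j} → j < n → suc (n ∸ suc j) ≤ n
    n-j≤n {j} j<n = ℕP.∸-monoʳ-< {n} {suc j} {0} (s≤s z≤n) j<n

-- Integral and Multiple ask for some fraction representing q, not the reduced one, so that
-- sums and products need no gcd reasoning; Multiple⇒O returns to lowest terms at the end.
module PAdic (p : ℕ) (p-prime : Prime p) where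

  instance
    p≢0 : NonZero p
    p≢0 = prime⇒nonZero p-prime

  p∤1 : ¬ p ∣ 1
  p∤1 p∣1 with ℕD.∣1⇒≡1 p∣1
  ... | refl = ¬prime[1] p-prime

  p∤* : ∀ {m n} → ¬ p ∣ m → ¬ p ∣ n → ¬ p ∣ m ℕ.* n
  p∤* {m} {n} p∤m p∤n p∣mn with euclidsLemma m n p-prime p∣mn
  ... | inj₁ p∣m = p∤m p∣m
  ... | inj₂ p∣n = p∤n p∣n

  p∤! : ∀ j → j < p → ¬ p ∣ j !
  p∤! zero    _   = p∤1
  p∤! (suc j) j<p = p∤* (λ p∣1+j → ℕP.<⇒≱ j<p (ℕD.∣⇒≤ p∣1+j)) (p∤! j (ℕP.<⇒≤ j<p))

  Integral : ℚ → Set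
  Integral q = Σ[ u ∈ ℚᵘ ] toℚᵘ q ℚᵘ.≃ u × ¬ p ∣ ℚᵘ.↧ₙ u

  Multiple : ℚ → Set
  Multiple q = Σ[ u ∈ ℚᵘ ] toℚᵘ q ℚᵘ.≃ u × ℤ.+ p ℤD.∣ ℚᵘ.↥ u × ¬ p ∣ ℚᵘ.↧ₙ u

  Integral-+ : ∀ {q r} → Integral q → Integral r → Integral (q + r)
  Integral-+ {q} {r} (u@(mkℚᵘ _ _) , q≃u , p∤u) (v@(mkℚᵘ _ _) , r≃v , p∤v) =
    u ℚᵘ.+ v , ℚᵘP.≃-trans (ℚP.toℚᵘ-homo-+ q r) (ℚᵘP.+-cong q≃u r≃v) , p∤* p∤u p∤v

  Integral-* : ∀ {q r} → Integral q → Integral r → Integral (q * r)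
  Integral-* {q} {r} (u@(mkℚᵘ _ _) , q≃u , p∤u) (v@(mkℚᵘ _ _) , r≃v , p∤v) =
    u ℚᵘ.* v , ℚᵘP.≃-trans (ℚP.toℚᵘ-homo-* q r) (ℚᵘP.*-cong q≃u r≃v) , p∤* p∤u p∤v

  Integral-neg : ∀ {q} → Integral q → Integral (- q)
  Integral-neg {q} (u@(mkℚᵘ _ _) , q≃u , p∤u) =
    ℚᵘ.- u , ℚᵘP.≃-trans (ℚP.toℚᵘ-homo‿- q) (ℚᵘP.-‿cong q≃u) , p∤u

  Multiple-+ : ∀ {q r} → Multiple q → Multiple r → Multiple (q + r)
  Multiple-+ {q} {r} (u@(mkℚᵘ _ _) , q≃u , p∣u , p∤u) (v@(mkℚᵘ _ _) , r≃v , p∣v , p∤v) =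
    u ℚᵘ.+ v , ℚᵘP.≃-trans (ℚP.toℚᵘ-homo-+ q r) (ℚᵘP.+-cong q≃u r≃v) ,
    ℤD.∣m∣n⇒∣m+n (ℤD.∣m⇒∣m*n (ℚᵘ.↧ v) p∣u) (ℤD.∣m⇒∣m*n (ℚᵘ.↧ u) p∣v) , p∤* p∤u p∤v

  Multiple*Integral : ∀ {q r} → Multiple q → Integral r → Multiple (q * r)
  Multiple*Integral {q} {r} (u@(mkℚᵘ _ _) , q≃u , p∣u , p∤u) (v@(mkℚᵘ b _) , r≃v , p∤v) =
    u ℚᵘ.* v , ℚᵘP.≃-trans (ℚP.toℚᵘ-homo-* q r) (ℚᵘP.*-cong q≃u r≃v) , ℤD.∣m⇒∣m*n b p∣u , p∤* p∤u p∤v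

  Integral*Multiple : ∀ {q r} → Integral q → Multiple r → Multiple (q * r)
  Integral*Multiple {q} {r} q-int r-mul = subst Multiple (ℚP.*-comm r q) (Multiple*Integral r-mul q-int)

  Multiple-neg : ∀ {q} → Multiple q → Multiple (- q)
  Multiple-neg {q} (u@(mkℚᵘ _ _) , q≃u , p∣u , p∤u) =
    ℚᵘ.- u , ℚᵘP.≃-trans (ℚP.toℚᵘ-homo‿- q) (ℚᵘP.-‿cong q≃u) , ℤD.∣m⇒∣-m p∣u , p∤u

  Integral-/ : ∀ (i : ℤ) d .{{_ : NonZero d}} → ¬ p ∣ d → Integral (i / d)
  Integral-/ i (suc d) p∤d = i ℚᵘ./ suc d , toℚᵘ-/ i (suc d) , p∤d

  Multiple-/ : ∀ (i : ℤ) d .{{_ : NonZero d}} → ℤ.+ p ℤD.∣ i → ¬ p ∣ d → Multiple (i / d)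
  Multiple-/ i (suc d) p∣i p∤d = i ℚᵘ./ suc d , toℚᵘ-/ i (suc d) , p∣i , p∤d

  Multiple⇒O : ∀ {q} → Multiple q → O[ p ] q
  Multiple⇒O {mkℚ n d coprime} (mkℚᵘ a b , *≡* n[1+b]≡a[1+d] , p∣a , p∤1+b) = p∣n , p∤1+d
    where
    p∣n : p ∣ ℤ.∣ n ∣
    p∣n with euclidsLemma ℤ.∣ n ∣ (suc b) p-prime
               (subst (p ∣_) (trans (cong ℤ.∣_∣ (sym n[1+b]≡a[1+d])) (ℤP.abs-* n (ℤ.+ suc b)))
                  (ℤD.∣⇒∣ᵤ (ℤD.∣m⇒∣m*n (ℤ.+ suc d) p∣a)))
    ... | inj₁ p∣n   = p∣n
    ... | inj₂ p∣1+b = ⊥-elim (p∤1+b p∣1+b)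
    p∤1+d : ¬ p ∣ suc d
    p∤1+d p∣1+d = p∤1 (subst (p ∣_) (ℕC.recompute coprime (p∣n , p∣1+d)) ℕD.∣-refl)

  Integral-fromℕ : ∀ n → Integral (fromℕ n)
  Integral-fromℕ n = Integral-/ (ℤ.+ n) 1 p∤1

  Integral-0ℚ : Integral 0ℚ
  Integral-0ℚ = Integral-fromℕ 0

  Integral-1ℚ : Integral 1ℚ
  Integral-1ℚ = Integral-fromℕ 1

  Integral-inv! : ∀ j → j < p → Integral (inv! j)
  Integral-inv! j j<p = Integral-/ (ℤ.+ 1) (j !) {{j ℕP.!≢0}} (p∤! j j<p)

  Integral-^ : ∀ {q} → Integral q → ∀ j → Integral (q ^ℚ j)
  Integral-^ q-int zero    = Integral-1ℚ
  Integral-^ q-int (suc j) = Integral-* q-int (Integral-^ q-int j)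

  Integral-when : ∀ {P : Set} (d : Dec P) {q} → Integral q → Integral (when d q)
  Integral-when (yes _) q-int = q-int
  Integral-when (no _)  _     = Integral-0ℚ

  Integral-if : ∀ (b : Bool) {q r} → Integral q → Integral r → Integral (if b then q else r)
  Integral-if true  q-int _     = q-int
  Integral-if false _     r-int = r-int

  Integral-∑ : ∀ n (f : ℕ → ℚ) → (∀ j → j < n → Integral (f j)) → Integral (∑ n f)
  Integral-∑ zero    f _   = Integral-0ℚ
  Integral-∑ (suc n) f int = Integral-+ (int 0 (s≤s z≤n)) (Integral-∑ n (λ j → f (suc j)) (λ j j<n → int (suc j) (s≤s j<n)))

  Integral-signFact : ∀ k → Integral (signFact k)
  Integral-signFact k =
    Integral-* (Integral-if ((k ∸ 1) % 2 ≡ᵇ 0) Integral-1ℚ (Integral-neg {1ℚ} Integral-1ℚ)) (Integral-fromℕ ((k ∸ 1) !))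

  Multiple-p* : ∀ n → Multiple (fromℕ (p ℕ.* n))
  Multiple-p* n = Multiple-/ (ℤ.+ (p ℕ.* n)) 1 (ℤD.∣ᵤ⇒∣ (ℕD.m∣m*n n)) p∤1

  Multiple-∑ : ∀ n (f : ℕ → ℚ) → (∀ j → j < n → Multiple (f j)) → Multiple (∑ n f)
  Multiple-∑ zero    f _   = Multiple-/ (ℤ.+ 0) 1 (ℤD.divides (ℤ.+ 0) refl) p∤1
  Multiple-∑ (suc n) f mul = Multiple-+ (mul 0 (s≤s z≤n)) (Multiple-∑ n (λ j → f (suc j)) (λ j j<n → mul (suc j) (s≤s j<n)))

  module _ (x : ℕ → ℚ) (x-integral : ∀ t → Integral (x t)) where

    open BellRecursion x

    Integral-partFactor : ∀ s j → s < p → j < p → Integral (partFactor s j)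
    Integral-partFactor s j s<p j<p =
      Integral-* (Integral-inv! j j<p) (Integral-^ (Integral-* (x-integral s) (Integral-inv! s s<p)) j)

    -- All part sizes are below p, and a part count j ≥ p is excluded either directly (k < p)
    -- or because it would weigh at least p s > n; so every factorial in a denominator is prime to p.
    Integral-bellFrom : ∀ m s n k → s ℕ.+ m ≤ p → k < p ⊎ n < p ℕ.* s → Integral (bellFrom s m n k)
    Integral-bellFrom zero    s n k _ _ = Integral-if ((0 ≡ᵇ k) ∧ (0 ≡ᵇ n)) Integral-1ℚ Integral-0ℚ
    Integral-bellFrom (suc m) s n k s+1+m≤p few = Integral-∑ (suc k) _ term
      where
      1+s+m≤p : suc s ℕ.+ m ≤ p
      1+s+m≤p = subst (_≤ p) (ℕP.+-suc s m) s+1+m≤p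
      s<p : s < p
      s<p = ℕP.≤-trans (s≤s (ℕP.m≤m+n s m)) 1+s+m≤p
      term : ∀ j → j < suc k → Integral (when (s ℕ.* j ≤? n) (partFactor s j * bellFrom (suc s) m (n ∸ s ℕ.* j) (k ∸ j)))
      term j j<1+k with j <? p
      ... | yes j<p = Integral-when (s ℕ.* j ≤? n)
              (Integral-* (Integral-partFactor s j s<p j<p) (Integral-bellFrom m (suc s) (n ∸ s ℕ.* j) (k ∸ j) 1+s+m≤p (stillFew few)))
        where
        stillFew : k < p ⊎ n < p ℕ.* s → k ∸ j < p ⊎ n ∸ s ℕ.* j < p ℕ.* suc s
        stillFew (inj₁ k<p)  = inj₁ (ℕP.≤-<-trans (ℕP.m∸n≤m k j) k<p)
        stillFew (inj₂ n<ps) =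
          inj₂ (ℕP.≤-<-trans (ℕP.m∸n≤m n (s ℕ.* j)) (ℕP.<-≤-trans n<ps (ℕP.*-monoʳ-≤ p (ℕP.n≤1+n s))))
      ... | no j≮p = subst Integral (sym (when-no (s ℕ.* j ≤? n) _ (tooMany few))) Integral-0ℚ
        where
        p≤j : p ≤ j
        p≤j = ℕP.≮⇒≥ j≮p
        tooMany : k < p ⊎ n < p ℕ.* s → ¬ s ℕ.* j ≤ n
        tooMany (inj₁ k<p)  _    = ℕP.<⇒≱ k<p (ℕP.≤-trans p≤j (ℕP.≤-pred j<1+k))
        tooMany (inj₂ n<ps) sj≤n =
          ℕP.<⇒≱ n<ps (ℕP.≤-trans (ℕP.≤-reflexive (ℕP.*-comm p s)) (ℕP.≤-trans (ℕP.*-monoʳ-≤ s p≤j) sj≤n))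

    -- With p < n < 2p, all p parts of size 1 would leave a positive weight and no parts;
    -- with j < p parts of size 1, Integral-bellFrom applies to the rest.
    Integral-bellFrom-p-parts : ∀ m n → 2 ℕ.+ m ≤ p → p < n → n < p ℕ.* 2 → Integral (bellFrom 1 (suc m) n p)
    Integral-bellFrom-p-parts m n 2+m≤p p<n n<2p = Integral-∑ (suc p) _ term
      where
      term : ∀ j → j < suc p → Integral (when (1 ℕ.* j ≤? n) (partFactor 1 j * bellFrom 2 m (n ∸ 1 ℕ.* j) (p ∸ j)))
      term j j<1+p with j <? p
      ... | yes j<p = Integral-when (1 ℕ.* j ≤? n)
              (Integral-* (Integral-partFactor 1 j (ℕP.≤-trans (s≤s (s≤s z≤n)) 2+m≤p) j<p)
                          (Integral-bellFrom m 2 (n ∸ 1 ℕ.* j) (p ∸ j) 2+m≤p (few j j<p)))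
        where
        few : ∀ j → j < p → p ∸ j < p ⊎ n ∸ 1 ℕ.* j < p ℕ.* 2
        few zero     _   = inj₂ n<2p
        few (suc j′) j<p = inj₁ (ℕP.∸-monoʳ-< {p} {suc j′} {0} (s≤s z≤n) (ℕP.<⇒≤ j<p))
      ... | no j≮p with ℕP.≤-antisym (ℕP.≤-pred j<1+p) (ℕP.≮⇒≥ j≮p)
      ...   | refl with ℕP.m≤n⇒∃[o]m+o≡n p<n
      ...     | d , refl rewrite ℕP.*-identityˡ j | ℕP.n∸n≡0 j | ℕP.+-∸-assoc 1 (ℕP.m≤m+n j d) | ℕP.m+n∸m≡n j d =
        subst Integral (sym (trans (cong (when (j ≤? suc j ℕ.+ d)) (trans (cong (partFactor 1 j *_) (bellFrom-noParts-suc m 2 d))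
                                                                          (ℚP.*-zeroʳ (partFactor 1 j))))
                                   (when-0ℚ (j ≤? suc j ℕ.+ d))))
          Integral-0ℚ

-- Σ_{k=1}^{p} (-1)^{k-1} (k-1)! S(p, k) = 0, and p divides S(p, k) for 1 < k < p; the
-- surviving terms k = 1 and k = p give 1 + (p-1)! ≡ 0 (mod p).
module Wilson (n : ℕ) (p-prime : Prime (2 ℕ.+ n)) (p≢2 : 2 ℕ.+ n ≢ 2) where

  p : ℕ
  p = 2 ℕ.+ n

  open PAdic p p-prime
  open StirlingNumbers

  sign[p]≡-1 : sign p ≡ - 1ℚ
  sign[p]≡-1 with p % 2 ≡ᵇ 0 in p%2≡ᵇ0
  ... | true  = ⊥-elim (p%2≢0 (ℕP.≡ᵇ⇒≡ _ 0 (subst T (sym p%2≡ᵇ0) _)))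
    where
    p%2≢0 : p % 2 ≢ 0
    p%2≢0 p%2≡0 with prime⇒irreducible p-prime (ℕD.m%n≡0⇒n∣m p 2 p%2≡0)
    ... | inj₁ ()
    ... | inj₂ 2≡p = p≢2 (sym 2≡p)
  ... | false = refl

  signFact-p : signFact p ≡ ℚ! (suc n)
  signFact-p = trans (cong (_* ℚ! (suc n)) (ℚP.neg-injective {sign (suc n)} {1ℚ} (trans (sym (sign-suc (suc n))) sign[p]≡-1)))
                     (ℚP.*-identityˡ (ℚ! (suc n)))

  Multiple-middleTerm : ∀ k → k < n → Multiple (ℚ! p * (signFact (2 ℕ.+ k) * bellFrom 1 p p (2 ℕ.+ k)))
  Multiple-middleTerm k k<n =
    subst Multiple (solve 3 (λ f s b → s :* (f :* b) := f :* (s :* b)) refl (ℚ! p) (signFact (2 ℕ.+ k)) (bellFrom 1 p p (2 ℕ.+ k)))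
      (Integral*Multiple (Integral-signFact (2 ℕ.+ k)) (Multiple*Integral (Multiple-p* (suc n !)) integral))
    where
    p<2+k+[1+n] : p < 1 ℕ.* (2 ℕ.+ k) ℕ.+ suc n
    p<2+k+[1+n] = subst (p <_) (cong (ℕ._+ suc n) (sym (ℕP.*-identityˡ (2 ℕ.+ k))))
                    (s≤s (s≤s (subst (suc n ≤_) (sym (ℕP.+-suc k n)) (s≤s (ℕP.m≤n+m n k)))))
    integral : Integral (bellFrom 1 p p (2 ℕ.+ k))
    integral = subst Integral (trans (bellFrom-moreSizes (suc n) 1 1 p (2 ℕ.+ k) p<2+k+[1+n])
                                     (cong (λ m → bellFrom 1 m p (2 ℕ.+ k)) (ℕP.+-comm (suc n) 1)))
                 (Integral-bellFrom (λ _ → 1ℚ) (λ _ → Integral-1ℚ) (suc n) 1 p (2 ℕ.+ k) ℕP.≤-refl (inj₁ (s≤s (s≤s k<n))))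

  wilson : Multiple (1ℚ + ℚ! (suc n))
  wilson = subst Multiple -middle≡1+[p-1]! (Multiple-neg (subst Multiple (∑-*ˡ n (ℚ! p) middle) (Multiple-∑ n _ Multiple-middleTerm)))
    where
    middle : ℕ → ℚ
    middle k = signFact (2 ℕ.+ k) * bellFrom 1 p p (2 ℕ.+ k)
    first last : ℚ
    first = signFact 1 * bellFrom 1 p p 1
    last  = signFact p * bellFrom 1 p p p
    ℚ!*first≡1 : ℚ! p * first ≡ 1ℚ
    ℚ!*first≡1 = trans (cong (ℚ! p *_) (trans (ℚP.*-identityˡ _) (bellFrom-singlePart p (suc n) ℕP.≤-refl))) (ℚ!*inv!≡1 p)
    ℚ!*last≡[p-1]! : ℚ! p * last ≡ ℚ! (suc n)
    ℚ!*last≡[p-1]! = begin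
        ℚ! p * (signFact p * bellFrom 1 p p p)
      ≡⟨ cong (λ z → ℚ! p * (signFact p * z)) (bellFrom-diagonal (suc n) p) ⟩
        ℚ! p * (signFact p * inv! p)
      ≡⟨ solve 3 (λ f s i → f :* (s :* i) := s :* (f :* i)) refl (ℚ! p) (signFact p) (inv! p) ⟩
        signFact p * (ℚ! p * inv! p)
      ≡⟨ cong (signFact p *_) (ℚ!*inv!≡1 p) ⟩
        signFact p * 1ℚ
      ≡⟨ ℚP.*-identityʳ _ ⟩
        signFact p
      ≡⟨ signFact-p ⟩
        ℚ! (suc n)
      ∎
      where open ≡-Reasoning
    X = ℚ! p * ∑ n middle
    1+X+[p-1]!≡0 : 1ℚ + (X + ℚ! (suc n)) ≡ 0ℚ
    1+X+[p-1]!≡0 = begin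
        1ℚ + (X + ℚ! (suc n))
      ≡⟨ sym (cong₂ _+_ ℚ!*first≡1 (cong (X +_) ℚ!*last≡[p-1]!)) ⟩
        ℚ! p * first + (X + ℚ! p * last)
      ≡⟨ solve 4 (λ f a b c → f :* a :+ (f :* b :+ f :* c) := f :* (a :+ (b :+ c))) refl (ℚ! p) first (∑ n middle) last ⟩
        ℚ! p * (first + (∑ n middle + last))
      ≡⟨ cong (λ z → ℚ! p * (first + z)) (sym (∑-snoc n middle)) ⟩
        ℚ! p * alternatingSum p p p
      ≡⟨ cong (ℚ! p *_) (alternatingSum-2+ (suc n) (suc n) n ℕP.≤-refl ℕP.≤-refl) ⟩
        ℚ! p * 0ℚ
      ≡⟨ ℚP.*-zeroʳ (ℚ! p) ⟩
        0ℚ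
      ∎
      where open ≡-Reasoning
    -middle≡1+[p-1]! : - X ≡ 1ℚ + ℚ! (suc n)
    -middle≡1+[p-1]! = sym (trans (solve 3 (λ x a b → a :+ b := (a :+ (x :+ b)) :+ (:- x)) refl X 1ℚ (ℚ! (suc n)))
                             (trans (cong (_+ - X) 1+X+[p-1]!≡0) (ℚP.+-identityˡ (- X))))

restrictedTo : ℕ → ℕ → ℚ
restrictedTo r t = if t ≤ᵇ r then 1ℚ else 0ℚ

stirlingLE-unrestricted : ∀ r n k → suc (n ∸ k) ≤ r → stirlingLE r n k ≡ stirling2 n k
stirlingLE-unrestricted r n k n-k<r with suc (n ∸ k) ≤ᵇ r in eq
... | true  = refl
... | false = ⊥-elim (subst T eq (ℕP.≤⇒≤ᵇ n-k<r))

stirlingLE-restricted : ∀ r n k → ¬ suc (n ∸ k) ≤ r → stirlingLE r n k ≡ bell n k (restrictedTo r)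
stirlingLE-restricted r n k n-k≮r with suc (n ∸ k) ≤ᵇ r in eq
... | true  = ⊥-elim (n-k≮r (ℕP.≤ᵇ⇒≤ (suc (n ∸ k)) r (subst T (sym eq) _)))
... | false = refl

-- The only set partition of {1, …, i+1} into one block has a block of size i+1 > i.
stirlingLE-singleBlock : ∀ i → stirlingLE i (suc i) 1 ≡ 0ℚ
stirlingLE-singleBlock i = trans (stirlingLE-restricted i (suc i) 1 (ℕP.<-irrefl refl))
  (trans (bell≡ℚ!*bellFrom (suc i) 1) (trans (cong (ℚ! (suc i) *_) noBlock) (ℚP.*-zeroʳ (ℚ! (suc i)))))
  where
  open BellRecursion (restrictedTo i)
  restrictedTo-suc : restrictedTo i (suc i) ≡ 0ℚ
  restrictedTo-suc with suc i ≤ᵇ i in eq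
  ... | true  = ⊥-elim (ℕP.<-irrefl refl (ℕP.≤ᵇ⇒≤ (suc i) i (subst T (sym eq) _)))
  ... | false = refl
  block : ∀ t → t < suc i → when (1 ℕ.+ t ≤? suc i) (y (1 ℕ.+ t) * bellFrom 1 (suc i) (suc i ∸ (1 ℕ.+ t)) 0) ≡ 0ℚ
  block t t<1+i with t <? i
  ... | yes t<i = trans (cong (λ z → when (1 ℕ.+ t ≤? suc i) (y (1 ℕ.+ t) * z))
                           (bellFrom-noParts-∸ (suc i) 1 (suc i) (suc t) (s≤s t<i)))
                    (trans (cong (when (1 ℕ.+ t ≤? suc i)) (ℚP.*-zeroʳ (y (1 ℕ.+ t)))) (when-0ℚ (1 ℕ.+ t ≤? suc i)))
  ... | no t≮i with ℕP.≤-antisym (ℕP.≤-pred t<1+i) (ℕP.≮⇒≥ t≮i)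
  ...   | refl = trans (cong (λ z → when (1 ℕ.+ t ≤? suc t) (z * inv! (suc t) * b)) restrictedTo-suc)
                   (trans (cong (when (1 ℕ.+ t ≤? suc t)) (trans (cong (_* b) (ℚP.*-zeroˡ (inv! (suc t)))) (ℚP.*-zeroˡ b)))
                          (when-0ℚ (1 ℕ.+ t ≤? suc t)))
    where b = bellFrom 1 (suc t) (suc t ∸ (1 ℕ.+ t)) 0
  noBlock : bellFrom 1 (suc (suc i ∸ 1)) (suc i) 1 ≡ 0ℚ
  noBlock = trans (sym (ℚP.*-identityˡ _)) (trans (count*bellFrom (suc i) 1 (suc i) 0) (∑-≡0 (suc i) block))

G-alternating : (i l : ℕ) → ℚ
G-alternating i l = sumℚ (map (λ k → signFact k * stirlingLE i l k) (map suc (upTo l)))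

G-correction : (p i l : ℕ) → ℚ
G-correction p i l = (ℤ.+ (p ℕ.* (l !)) / ((l ℕ.+ p ∸ 1) !)) {{(l ℕ.+ p ∸ 1) ℕP.!≢0}} * stirlingLE i (l ℕ.+ p ∸ 1) p

G-alternating≡∑ : ∀ i l → G-alternating i l ≡ ∑[ j < l ] (signFact (suc j) * stirlingLE i l (suc j))
G-alternating≡∑ i l = trans (cong sumℚ (sym (map-∘ (upTo l))))
  (sumℚ-map-applyUpTo l (λ j → signFact (suc j) * stirlingLE i l (suc j)) (λ j → j))

G-alternating-unrestricted : ∀ i l → l ≤ i → G-alternating i l ≡ ℚ! l * StirlingNumbers.alternatingSum l l l
G-alternating-unrestricted i l l≤i = trans (G-alternating≡∑ i l)
  (trans (∑-cong l (λ j j<l → cong (signFact (suc j) *_) (stirlingLE-unrestricted i l (suc j) (l-j≤i j<l))))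
         (StirlingNumbers.∑signFact*stirling2 l))
  where
  l-j≤i : ∀ {j} → j < l → suc (l ∸ suc j) ≤ i
  l-j≤i {j} j<l = ℕP.≤-trans (ℕP.∸-monoʳ-< {l} {suc j} {0} (s≤s z≤n) j<l) l≤i

module Main (n : ℕ) (p-prime : Prime (2 ℕ.+ n)) (p≢2 : 2 ℕ.+ n ≢ 2) where

  open Wilson n p-prime p≢2 using (p; wilson)
  open PAdic p p-prime
  open StirlingNumbers using (alternatingSum-1; alternatingSum-2+; stirling2-singlePart; stirling2-diagonal; ∑signFact*stirling2)

  Integral-restrictedTo : ∀ r t → Integral (restrictedTo r t)
  Integral-restrictedTo r t = Integral-if (t ≤ᵇ r) Integral-1ℚ Integral-0ℚ

  -- p l! / (l+p-1)! · S_{≤i}(l+p-1, p) = p l! · bellFrom(l+p-1, p), and the latter is p-integral.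
  Multiple-G-correction-viaBell : ∀ i l → 1 ≤ l → l ≤ i → i < p ∸ 1 → ∀ x → (∀ t → Integral (x t)) →
    stirlingLE i (l ℕ.+ p) p ≡ ℚ! (l ℕ.+ p) * BellRecursion.bellFrom x 1 (suc (l ℕ.+ p ∸ p)) (l ℕ.+ p) p →
    Multiple (G-correction p i (suc l))
  Multiple-G-correction-viaBell i l 1≤l l≤i i<p-1 x x-integral S≡ℚ!*b =
    subst Multiple (sym correction≡) (Multiple*Integral (Multiple-p* (suc l !)) b-integral)
    where
    N = l ℕ.+ p
    b = BellRecursion.bellFrom x 1 (suc (N ∸ p)) N p
    c = (ℤ.+ (p ℕ.* (suc l !)) / (N !)) {{N ℕP.!≢0}}
    correction≡ : c * stirlingLE i N p ≡ fromℕ (p ℕ.* (suc l !)) * b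
    correction≡ = trans (cong (c *_) S≡ℚ!*b)
      (trans (sym (ℚP.*-assoc c (ℚ! N) b)) (cong (_* b) ([a/b]*b≡a (p ℕ.* (suc l !)) (N !) {{N ℕP.!≢0}})))
    2+i≤p : 2 ℕ.+ i ≤ p
    2+i≤p = s≤s i<p-1
    l<p : l < p
    l<p = ℕP.≤-trans (s≤s l≤i) (ℕP.<⇒≤ 2+i≤p)
    b-integral : Integral b
    b-integral = subst (λ z → Integral (BellRecursion.bellFrom x 1 (suc z) N p)) (sym (ℕP.m+n∸n≡m l p))
      (Integral-bellFrom-p-parts x x-integral l N (ℕP.≤-trans (s≤s (s≤s l≤i)) 2+i≤p)
        (subst (p <_) (ℕP.+-comm p l) (ℕP.m<m+n p 1≤l))
        (subst (N <_) (trans (cong (p ℕ.+_) (sym (ℕP.+-identityʳ p))) (ℕP.*-comm 2 p)) (ℕP.+-monoˡ-< p l<p)))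

  Multiple-G-correction : ∀ i l → 1 ≤ l → l ≤ i → i < p ∸ 1 → Multiple (G-correction p i (suc l))
  Multiple-G-correction i l 1≤l l≤i i<p-1 with suc (l ℕ.+ p ∸ p) ≤? i
  ... | yes unrestricted = Multiple-G-correction-viaBell i l 1≤l l≤i i<p-1 (λ _ → 1ℚ) (λ _ → Integral-1ℚ)
    (trans (stirlingLE-unrestricted i (l ℕ.+ p) p unrestricted) (BellRecursion.bell≡ℚ!*bellFrom _ (l ℕ.+ p) p))
  ... | no restricted = Multiple-G-correction-viaBell i l 1≤l l≤i i<p-1 (restrictedTo i) (Integral-restrictedTo i)
    (trans (stirlingLE-restricted i (l ℕ.+ p) p restricted) (BellRecursion.bell≡ℚ!*bellFrom _ (l ℕ.+ p) p))

  G-1 : ∀ i → 1 ≤ i → Multiple (G p i 1)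
  G-1 i 1≤i = subst Multiple (sym G≡) (Multiple*Integral wilson (Integral-inv! (suc n) ℕP.≤-refl))
    where
    c = (ℤ.+ (p ℕ.* 1) / (p !)) {{p ℕP.!≢0}}
    c≡inv![p-1] : c ≡ inv! (suc n)
    c≡inv![p-1] = begin
        c                        ≡⟨ sym (ℚP.*-identityʳ c) ⟩
        c * 1ℚ                   ≡⟨ cong (c *_) (sym (ℚ!*inv!≡1 p)) ⟩
        c * (ℚ! p * inv! p)      ≡⟨ sym (ℚP.*-assoc c (ℚ! p) (inv! p)) ⟩
        c * ℚ! p * inv! p        ≡⟨ cong (_* inv! p) ([a/b]*b≡a (p ℕ.* 1) (p !) {{p ℕP.!≢0}}) ⟩
        fromℕ (p ℕ.* 1) * inv! p ≡⟨ cong (λ z → fromℕ z * inv! p) (ℕP.*-identityʳ p) ⟩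
        fromℕ p * inv! p         ≡⟨ ℚP.*-comm (fromℕ p) (inv! p) ⟩
        inv! p * fromℕ p         ≡⟨ inv!-suc (suc n) ⟩
        inv! (suc n)             ∎
      where open ≡-Reasoning
    S≤i[p,p]≡1 : stirlingLE i p p ≡ 1ℚ
    S≤i[p,p]≡1 = trans (stirlingLE-unrestricted i p p (subst (λ z → suc z ≤ i) (sym (ℕP.n∸n≡0 p)) 1≤i))
                       (stirling2-diagonal (suc n))
    G≡ : G p i 1 ≡ (1ℚ + ℚ! (suc n)) * inv! (suc n)
    G≡ = begin
        G-alternating i 1 + c * stirlingLE i p p
      ≡⟨ cong₂ _+_ (trans (G-alternating-unrestricted i 1 1≤i) (cong (ℚ! 1 *_) (alternatingSum-1 0 0)))
                   (trans (cong₂ _*_ c≡inv![p-1] S≤i[p,p]≡1) (ℚP.*-identityʳ (inv! (suc n)))) ⟩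
        1ℚ + inv! (suc n)
      ≡⟨ ℚP.+-comm 1ℚ (inv! (suc n)) ⟩
        inv! (suc n) + 1ℚ
      ≡⟨ cong₂ _+_ (sym (ℚP.*-identityˡ (inv! (suc n)))) (sym (ℚ!*inv!≡1 (suc n))) ⟩
        1ℚ * inv! (suc n) + ℚ! (suc n) * inv! (suc n)
      ≡⟨ sym (ℚP.*-distribʳ-+ (inv! (suc n)) 1ℚ (ℚ! (suc n))) ⟩
        (1ℚ + ℚ! (suc n)) * inv! (suc n)
      ∎
      where open ≡-Reasoning

  G-2+ : ∀ i l → 2 ℕ.+ l ≤ i → i < p ∸ 1 → Multiple (G p i (2 ℕ.+ l))
  G-2+ i l 2+l≤i i<p-1 = subst Multiple (sym G≡) (Multiple-G-correction i (suc l) (s≤s z≤n) (ℕP.<⇒≤ 2+l≤i) i<p-1)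
    where
    G≡ : G p i (2 ℕ.+ l) ≡ G-correction p i (2 ℕ.+ l)
    G≡ = trans (cong (_+ G-correction p i (2 ℕ.+ l))
                 (trans (G-alternating-unrestricted i (2 ℕ.+ l) 2+l≤i)
                   (trans (cong (ℚ! (2 ℕ.+ l) *_) (alternatingSum-2+ (suc l) (suc l) l ℕP.≤-refl ℕP.≤-refl))
                          (ℚP.*-zeroʳ (ℚ! (2 ℕ.+ l))))))
               (ℚP.+-identityˡ _)

  -- For l = i + 1 only S_{≤i}(i+1, 1) = 0 differs from S(i+1, 1) = 1, so the alternating part is 0 - 1.
  G-top : ∀ i → suc i < p ∸ 1 → Multiple (G p (suc i) (2 ℕ.+ i) + 1ℚ)
  G-top i i<p-1 = subst Multiple (sym G+1≡) (Multiple-G-correction (suc i) (suc i) (s≤s z≤n) ℕP.≤-refl i<p-1)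
    where
    C = G-correction p (suc i) (2 ℕ.+ i)
    rest = ∑[ j < suc i ] (signFact (2 ℕ.+ j) * stirling2 (2 ℕ.+ i) (2 ℕ.+ j))
    1+rest≡0 : 1ℚ + rest ≡ 0ℚ
    1+rest≡0 = begin
        1ℚ + rest
      ≡⟨ cong (_+ rest) (sym (trans (ℚP.*-identityˡ _) (stirling2-singlePart (suc i)))) ⟩
        signFact 1 * stirling2 (2 ℕ.+ i) 1 + rest
      ≡⟨ ∑signFact*stirling2 (2 ℕ.+ i) ⟩
        ℚ! (2 ℕ.+ i) * StirlingNumbers.alternatingSum (2 ℕ.+ i) (2 ℕ.+ i) (2 ℕ.+ i)
      ≡⟨ cong (ℚ! (2 ℕ.+ i) *_) (alternatingSum-2+ (suc i) (suc i) i ℕP.≤-refl ℕP.≤-refl) ⟩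
        ℚ! (2 ℕ.+ i) * 0ℚ
      ≡⟨ ℚP.*-zeroʳ (ℚ! (2 ℕ.+ i)) ⟩
        0ℚ
      ∎
      where open ≡-Reasoning
    restricted≡rest : ∑[ j < suc i ] (signFact (2 ℕ.+ j) * stirlingLE (suc i) (2 ℕ.+ i) (2 ℕ.+ j)) ≡ rest
    restricted≡rest = ∑-cong (suc i) (λ j j<1+i → cong (signFact (2 ℕ.+ j) *_)
      (stirlingLE-unrestricted (suc i) (2 ℕ.+ i) (2 ℕ.+ j) (ℕP.∸-monoʳ-< {suc i} {suc j} {0} (s≤s z≤n) j<1+i)))
    G+1≡ : G p (suc i) (2 ℕ.+ i) + 1ℚ ≡ C
    G+1≡ = begin
        G-alternating (suc i) (2 ℕ.+ i) + C + 1ℚ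
      ≡⟨ cong (λ z → z + C + 1ℚ) (trans (G-alternating≡∑ (suc i) (2 ℕ.+ i))
                                         (cong₂ _+_ (cong (signFact 1 *_) (stirlingLE-singleBlock (suc i))) restricted≡rest)) ⟩
        signFact 1 * 0ℚ + rest + C + 1ℚ
      ≡⟨ solve 3 (λ s r c → s :* con 0ℚ :+ r :+ c :+ con 1ℚ := (con 1ℚ :+ r) :+ c) refl (signFact 1) rest C ⟩
        (1ℚ + rest) + C
      ≡⟨ cong (_+ C) 1+rest≡0 ⟩
        0ℚ + C
      ≡⟨ ℚP.+-identityˡ C ⟩
        C
      ∎
      where open ≡-Reasoning

proposition3p17 : (p i l : ℕ) → Prime p → p ≢ 2 → 1 ≤ i → i < p ∸ 1 → 1 ≤ l → l ≤ suc i →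
    (l ≡ suc i → O[ p ] (G p i l + 1ℚ)) × (l ≤ i → O[ p ] (G p i l))
proposition3p17 zero          i l p-prime _ _ _ _ _ = ⊥-elim (¬prime[0] p-prime)
proposition3p17 (suc zero)    i l p-prime _ _ _ _ _ = ⊥-elim (¬prime[1] p-prime)
proposition3p17 (suc (suc n)) (suc i) l p-prime p≢2 _ i<p-1 1≤l _ =
  (λ { refl → Multiple⇒O (G-top i i<p-1) }) , λ l≤1+i → Multiple⇒O (below l 1≤l l≤1+i)
  where
  open Main n p-prime p≢2
  open PAdic (suc (suc n)) p-prime using (Multiple; Multiple⇒O)
  below : ∀ l → 1 ≤ l → l ≤ suc i → Multiple (G (suc (suc n)) (suc i) l)
  below (suc zero)     _ _       = G-1 (suc i) (s≤s z≤n)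
  below (suc (suc l′)) _ 2+l′≤1+i = G-2+ (suc i) l′ 2+l′≤1+i i<p-1
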